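{- Let $\alpha\in\Pi$ with $m_\alpha=1$. Then the face $F_\alpha:=\operatorname{conv}(\Phi)\cap\{x\in E\mid(x,\check\omega_\alpha)=m_\alpha\}$ of the root polytope $\operatorname{conv}(\Phi)$ is a facet (it has dimension $n-1$), and the abelian nilradical $\{\beta\in\Phi^+\mid \alpha\le\beta\}$ equals $F_\alpha\cap\Phi$. That is, every nonempty abelian nilradical of $\Phi^+$ is a facet ideal.
   Context: $\Phi$ is an irreducible crystallographic root system spanning a Euclidean space $E$ with inner product $(\cdot,\cdot)$, $n=\dim E$, $\Phi^+$ a positive system with simple system $\Pi$. $\theta$ is the highest root and $m_\alpha$ the coefficient of $\alpha\in\Pi$ in $\theta$. $\check\omega_\alpha$ is the fundamental coweight: $(\alpha,\check\omega_\alpha)=1$, $(\alpha',\check\omega_\alpha)=0$ for $\alpha'\in\Pi\setminus\{\alpha\}$. The standard partial order: $x\le y$ iff $y-x$ is a nonnegative integer combination of $\Pi$. A facet ideal is a set $F\cap\Phi$ where $F$ is a face of the form $F_\alpha$ ($\alpha\in\Pi$) which is a facet of $\operatorname{conv}(\Phi)$.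
   Formalization: The Euclidean space E is ℚ^n with a rational inner product, so the roots have rational coordinates and conv(Φ) is formed from rational convex combinations. -}

module Defs where

open import Data.Nat using (ℕ; zero; suc)
open import Data.Integer using (ℤ)
import Data.Integer as ℤ
open import Data.Rational using (ℚ; 0ℚ; 1ℚ; _+_; _*_; -_; _≤_; _<_; _/_)
open import Data.Fin using (Fin; zero; suc)
open import Data.Vec using (Vec; zipWith; map; replicate; lookup)
open import Data.List using (List; length)
import Data.List as List
open import Data.List.Membership.Propositional using (_∈_)
open import Data.Product using (Σ; ∃; _×_; _,_)
open import Data.Sum using (_⊎_)
open import Data.Empty using (⊥)
open import Relation.Nullary using (¬_)
open import Data.Bool using (Bool; true; false)
open import Relation.Binary.PropositionalEquality using (_≡_; _≢_)
open import Function using (_∘_)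

-- The Euclidean space E is modelled as ℚ^n.
V : ℕ → Set
V n = Vec ℚ n

0ᵥ : ∀ {n} → V n
0ᵥ = replicate _ 0ℚ

infixl 6 _+ᵥ_ _-ᵥ_
infixl 7 _•_

_+ᵥ_ : ∀ {n} → V n → V n → V n
_+ᵥ_ = zipWith _+_

_•_ : ∀ {n} → ℚ → V n → V n
c • v = map (c *_) v

-ᵥ_ : ∀ {n} → V n → V n
-ᵥ v = map -_ v

_-ᵥ_ : ∀ {n} → V n → V n → V n
u -ᵥ v = u +ᵥ (-ᵥ v)

ℤ→ℚ : ℤ → ℚ
ℤ→ℚ z = z / 1

ℕ→ℚ : ℕ → ℚ
ℕ→ℚ k = ℤ.+ k / 1

∑ : ∀ {k} → (Fin k → ℚ) → ℚ
∑ {zero} f = 0ℚ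
∑ {suc k} f = f zero + ∑ (f ∘ suc)

∑ᵥ : ∀ {n k} → (Fin k → V n) → V n
∑ᵥ {k = zero} f = 0ᵥ
∑ᵥ {k = suc k} f = f zero +ᵥ ∑ᵥ (f ∘ suc)

Gram : ℕ → Set
Gram n = Fin n → Fin n → ℚ

⟪_,_⟫[_] : ∀ {n} → V n → V n → Gram n → ℚ
⟪ x , y ⟫[ G ] = ∑ (λ i → ∑ (λ j → lookup x i * G i j * lookup y j))

IsEuclidean : ∀ {n} → Gram n → Set
IsEuclidean {n} G =
  (∀ i j → G i j ≡ G j i) × (∀ (x : V n) → x ≢ 0ᵥ → 0ℚ < ⟪ x , x ⟫[ G ])

root : ∀ {n} (Φ : List (V n)) → Fin (length Φ) → V n
root Φ = List.lookup Φ

InSpan : ∀ {n} → List (V n) → V n → Set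
InSpan Φ x = Σ (Fin (length Φ) → ℚ) λ c → ∑ᵥ (λ j → c j • root Φ j) ≡ x

InConv : ∀ {n} → List (V n) → V n → Set
InConv Φ x = Σ (Fin (length Φ) → ℚ) λ c →
  (∀ j → 0ℚ ≤ c j) × (∑ c ≡ 1ℚ) × (∑ᵥ (λ j → c j • root Φ j) ≡ x)

record IsRootSystem {n} (G : Gram n) (Φ : List (V n)) : Set where
  field
    spans : ∀ (x : V n) → InSpan Φ x
    nonzero : ¬ (0ᵥ ∈ Φ)
    reduced : ∀ {α} → α ∈ Φ → ∀ (c : ℚ) → c • α ∈ Φ → (c ≡ 1ℚ) ⊎ (c ≡ - 1ℚ)
    -- for α, β ∈ Φ the number z = 2(β,α)/(α,α) is an integer and
    -- the reflection s_α(β) = β - z α lies in Φ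
    crystallographic : ∀ {α β} → α ∈ Φ → β ∈ Φ →
      Σ ℤ λ z → (ℕ→ℚ 2 * ⟪ β , α ⟫[ G ] ≡ ℤ→ℚ z * ⟪ α , α ⟫[ G ])
              × ((β -ᵥ ℤ→ℚ z • α) ∈ Φ)

IsIrreducible : ∀ {n} (G : Gram n) (Φ : List (V n)) → Set
IsIrreducible {n} G Φ = ∀ (P : V n → Bool) →
  (∀ {β γ} → β ∈ Φ → γ ∈ Φ → P β ≡ true → P γ ≡ false → ⟪ β , γ ⟫[ G ] ≡ 0ℚ) →
  (∀ {β} → β ∈ Φ → P β ≡ true) ⊎ (∀ {β} → β ∈ Φ → P β ≡ false)

ℕComb : ∀ {n} → (Fin n → V n) → (Fin n → ℕ) → V n
ℕComb Π k = ∑ᵥ (λ i → ℕ→ℚ (k i) • Π i)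

LinIndep : ∀ {n k} → (Fin k → V n) → Set
LinIndep v = ∀ (c : Fin _ → ℚ) → ∑ᵥ (λ i → c i • v i) ≡ 0ᵥ → ∀ i → c i ≡ 0ℚ

record IsSimpleSystem {n} (Φ : List (V n)) (Π : Fin n → V n) : Set where
  field
    inΦ : ∀ i → Π i ∈ Φ
    indep : LinIndep Π
    signed : ∀ {β} → β ∈ Φ → Σ (Fin n → ℕ) λ k →
      (β ≡ ℕComb Π k) ⊎ (β ≡ -ᵥ ℕComb Π k)

_≼[_]_ : ∀ {n} → V n → (Fin n → V n) → V n → Set
x ≼[ Π ] y = Σ (Fin _ → ℕ) λ k → y -ᵥ x ≡ ℕComb Π k

IsPositiveRoot : ∀ {n} → List (V n) → (Fin n → V n) → V n → Set
IsPositiveRoot Φ Π β = (β ∈ Φ) × Σ (Fin _ → ℕ) λ k → β ≡ ℕComb Π k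

IsHighestRoot : ∀ {n} → List (V n) → (Fin n → V n) → V n → Set
IsHighestRoot Φ Π θ = (θ ∈ Φ) × (∀ {β} → β ∈ Φ → β ≼[ Π ] θ)

IsFundCoweight : ∀ {n} → Gram n → (Fin n → V n) → Fin n → V n → Set
IsFundCoweight G Π i ω = (⟪ Π i , ω ⟫[ G ] ≡ 1ℚ) ×
  (∀ j → j ≢ i → ⟪ Π j , ω ⟫[ G ] ≡ 0ℚ)

InFace : ∀ {n} → Gram n → List (V n) → V n → ℚ → V n → Set
InFace G Φ ω m x = InConv Φ x × (⟪ x , ω ⟫[ G ] ≡ m)

AffIndep : ∀ {n k} → (Fin (suc k) → V n) → Set
AffIndep p = LinIndep (λ i → p (suc i) -ᵥ p zero)

HasDim : ∀ {n} → (V n → Set) → ℕ → Set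
HasDim {n} S d =
  (Σ (Fin (suc d) → V n) λ p → (∀ i → S (p i)) × AffIndep p)
  × (∀ (p : Fin (suc (suc d)) → V n) → (∀ i → S (p i)) → ¬ AffIndep p)

-- The face F lies in the affine hyperplane ⟪ x , ω ⟫ = 1, so no n + 1 of its points are affinely
-- independent.  For the lower bound, call a simple root Π j attached if j = α or Π j is the
-- difference of two roots of F.  If Π i is attached and Π j is not, then ⟪ Π i , Π j ⟫ = 0:
-- otherwise adding Π j to, or subtracting it from, a root of F would exhibit Π j as such a
-- difference.  Since the support of a root is connected and θ involves every simple root, all Π j
-- are attached.  Averaging Π α with one root of each pair, and then trading one pair member for
-- the other, gives n points of F whose differences from the first are positive multiples of the
-- Π j with j ≢ α.  Finally, a root lies on F iff its α-coefficient is 1 = m α, that is iff it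
-- lies above Π α.
module Submission where

open import Defs
open import Data.Nat as ℕ using (ℕ; _∸_; zero; suc)
import Data.Nat.Properties as ℕP
open import Data.Integer as ℤ using (ℤ)
import Data.Integer.Properties as ℤP
open import Data.Rational as Q using (ℚ; 0ℚ; 1ℚ; mkℚ; _+_; _*_; -_; _-_; _≤_; _<_)
import Data.Rational.Properties as QP
open import Data.Rational.Solver using (module +-*-Solver)
open +-*-Solver using (solve; _:=_; _:+_; _:*_; :-_; _:-_; con)
import Data.Nat.Coprimality as Coprime
open import Algebra.Properties.Group QP.+-0-group using (x∙y⁻¹≈ε⇒x≈y)
open import Algebra.Properties.Monoid.Sum ℕP.+-0-monoid using (sum)
open import Data.Fin as F using (Fin; zero; suc; punchIn)
import Data.Fin.Properties as FP
open import Data.List using (List; length)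
open import Data.List.Membership.Propositional using (_∈_; find; lose)
import Data.List.Relation.Unary.Any as Any
import Data.List.Relation.Unary.Any.Properties as AnyP
open import Data.Vec using (lookup)
import Data.Vec.Properties as VP
open import Data.Vec.Functional using (insertAt; updateAt)
open import Data.Vec.Functional.Properties using (insertAt-lookup; insertAt-punchIn; updateAt-updates; updateAt-minimal)
open import Data.Product using (Σ; ∃; _×_; _,_; proj₁; proj₂)
open import Data.Sum using (_⊎_; inj₁; inj₂; [_,_])
open import Data.Empty using (⊥; ⊥-elim)
open import Function using (_∘_)
open import Function.Bundles using (_⇔_; mk⇔)
open import Relation.Nullary using (¬_; Dec; yes; no; ¬?)
open import Relation.Nullary.Decidable using (decidable-stable; map′; _×-dec_; _⊎-dec_)
open import Relation.Binary.Definitions using (Tri; tri<; tri≈; tri>)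
open import Relation.Binary.PropositionalEquality using (_≡_; _≢_; _≗_; refl; sym; trans; cong; cong₂; subst; module ≡-Reasoning)

ℕ→ℚ≡mkℚ : ∀ k → ℕ→ℚ k ≡ mkℚ (ℤ.+ k) 0 (Coprime.sym (Coprime.1-coprimeTo k))
ℕ→ℚ≡mkℚ k = QP.↥p/↧p≡p _

ℕ→ℚ-+ : ∀ a b → ℕ→ℚ (a ℕ.+ b) ≡ ℕ→ℚ a + ℕ→ℚ b
ℕ→ℚ-+ a b = trans (QP./-cong numerator refl) (sym (cong₂ _+_ (ℕ→ℚ≡mkℚ a) (ℕ→ℚ≡mkℚ b)))
  where
  numerator : ℤ.+ (a ℕ.+ b) ≡ ℤ.+ a ℤ.* ℤ.+ 1 ℤ.+ ℤ.+ b ℤ.* ℤ.+ 1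
  numerator = sym (cong₂ ℤ._+_ (ℤP.*-identityʳ (ℤ.+ a)) (ℤP.*-identityʳ (ℤ.+ b)))

ℕ→ℚ-suc : ∀ k → ℕ→ℚ (suc k) ≡ ℕ→ℚ k + 1ℚ
ℕ→ℚ-suc k = trans (cong ℕ→ℚ (ℕP.+-comm 1 k)) (ℕ→ℚ-+ k 1)

ℕ→ℚ-pred : ∀ {k} → 0 ℕ.< k → ℕ→ℚ (ℕ.pred k) ≡ ℕ→ℚ k - 1ℚ
ℕ→ℚ-pred {suc k} _ = sym (trans (cong (_- 1ℚ) (ℕ→ℚ-suc k)) (solve 1 (λ x → x :+ con 1ℚ :- con 1ℚ := x) refl (ℕ→ℚ k)))

ℕ→ℚ-nonNeg : ∀ k → 0ℚ ≤ ℕ→ℚ k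
ℕ→ℚ-nonNeg k = QP.nonNegative⁻¹ _ {{QP.normalize-nonNeg k 1}}

ℕ→ℚ-pos : ∀ {k} → 0 ℕ.< k → 0ℚ < ℕ→ℚ k
ℕ→ℚ-pos {suc k} _ = QP.positive⁻¹ _ {{QP.normalize-pos (suc k) 1}}

ℕ→ℚ-injective : ∀ {a b} → ℕ→ℚ a ≡ ℕ→ℚ b → a ≡ b
ℕ→ℚ-injective {a} {b} e = ℤP.+-injective (cong Q.↥_ (trans (sym (ℕ→ℚ≡mkℚ a)) (trans e (ℕ→ℚ≡mkℚ b))))

*-cancelʳ-pos : ∀ {p q r} → 0ℚ < r → p * r ≡ q * r → p ≡ q
*-cancelʳ-pos {r = r} 0<r e = QP.≤-antisym (cancel (QP.≤-reflexive e)) (cancel (QP.≤-reflexive (sym e)))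
  where
  cancel : ∀ {x y} → x * r ≤ y * r → x ≤ y
  cancel = QP.*-cancelʳ-≤-pos r {{Q.positive 0<r}}

p≤p+q : ∀ p {q} → 0ℚ ≤ q → p ≤ p + q
p≤p+q p 0≤q = subst (_≤ p + _) (QP.+-identityʳ p) (QP.+-monoʳ-≤ p 0≤q)

0≤q-p⇒p≤q : ∀ {p q} → 0ℚ ≤ q - p → p ≤ q
0≤q-p⇒p≤q {p} {q} 0≤q-p = subst (p ≤_) (solve 2 (λ p q → p :+ (q :- p) := q) refl p q) (p≤p+q p 0≤q-p)

p≤q⇒p-q≤0 : ∀ {p q} → p ≤ q → p - q ≤ 0ℚ
p≤q⇒p-q≤0 {p} {q} p≤q = subst (p - q ≤_) (QP.+-inverseʳ q) (QP.+-monoˡ-≤ (- q) p≤q)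

p-0≡p : ∀ p → p - 0ℚ ≡ p
p-0≡p = QP.+-identityʳ

0<1-0 : ∀ {p q} → p ≡ 1ℚ → q ≡ 0ℚ → 0ℚ < p - q
0<1-0 refl refl = QP.positive⁻¹ 1ℚ

0-1<0 : ∀ {p q} → p ≡ 0ℚ → q ≡ 1ℚ → p - q < 0ℚ
0-1<0 refl refl = QP.negative⁻¹ (- 1ℚ)

0<ℕ→ℚ*⇒0< : ∀ k q → 0ℚ < ℕ→ℚ k * q → 0 ℕ.< k
0<ℕ→ℚ*⇒0< zero q 0<0q = ⊥-elim (QP.<-irrefl (sym (QP.*-zeroˡ q)) 0<0q)
0<ℕ→ℚ*⇒0< (suc k) _ _ = ℕ.s≤s ℕ.z≤n

*-nonNeg : ∀ {p q} → 0ℚ ≤ p → 0ℚ ≤ q → 0ℚ ≤ p * q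
*-nonNeg {p} {q} 0≤p 0≤q = QP.nonNegative⁻¹ _ {{QP.nonNeg*nonNeg⇒nonNeg p {{Q.nonNegative 0≤p}} q {{Q.nonNegative 0≤q}}}}

*-pos : ∀ {p q} → 0ℚ < p → 0ℚ < q → 0ℚ < p * q
*-pos {p} {q} 0<p 0<q = QP.positive⁻¹ _ {{QP.pos*pos⇒pos p {{Q.positive 0<p}} q {{Q.positive 0<q}}}}

0<*⇒0<ʳ : ∀ {p q} → 0ℚ ≤ p → 0ℚ < p * q → 0ℚ < q
0<*⇒0<ʳ {p} {q} 0≤p 0<pq with 0ℚ QP.<? q
... | yes 0<q = 0<q
... | no 0≮q = ⊥-elim (QP.<-irrefl refl (QP.<-≤-trans 0<pq
        (QP.nonPositive⁻¹ _ {{QP.nonNeg*nonPos⇒nonPos p {{Q.nonNegative 0≤p}} q {{Q.nonPositive (QP.≮⇒≥ 0≮q)}}}})))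

∑-cong : ∀ {k} {f g : Fin k → ℚ} → f ≗ g → ∑ f ≡ ∑ g
∑-cong {zero} e = refl
∑-cong {suc k} e = cong₂ _+_ (e zero) (∑-cong (e ∘ suc))

∑-zero : ∀ {k} (f : Fin k → ℚ) → (∀ i → f i ≡ 0ℚ) → ∑ f ≡ 0ℚ
∑-zero {zero} f e = refl
∑-zero {suc k} f e = trans (cong₂ _+_ (e zero) (∑-zero (f ∘ suc) (e ∘ suc))) (QP.+-identityˡ 0ℚ)

∑-+ : ∀ {k} (f g : Fin k → ℚ) → ∑ (λ i → f i + g i) ≡ ∑ f + ∑ g
∑-+ {zero} f g = refl
∑-+ {suc k} f g = trans (cong ((f zero + g zero) +_) (∑-+ (f ∘ suc) (g ∘ suc)))
  (solve 4 (λ a b c d → (a :+ b) :+ (c :+ d) := (a :+ c) :+ (b :+ d)) refl (f zero) (g zero) (∑ (f ∘ suc)) (∑ (g ∘ suc)))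

∑-* : ∀ {k} (c : ℚ) (f : Fin k → ℚ) → ∑ (λ i → c * f i) ≡ c * ∑ f
∑-* {zero} c f = sym (QP.*-zeroʳ c)
∑-* {suc k} c f = trans (cong ((c * f zero) +_) (∑-* c (f ∘ suc))) (sym (QP.*-distribˡ-+ c (f zero) _))

∑-neg : ∀ {k} (f : Fin k → ℚ) → ∑ (λ i → - f i) ≡ - ∑ f
∑-neg {zero} f = refl
∑-neg {suc k} f = trans (cong ((- f zero) +_) (∑-neg (f ∘ suc))) (sym (QP.neg-distrib-+ (f zero) _))

∑-swap : ∀ {k l} (f : Fin k → Fin l → ℚ) → ∑ (λ i → ∑ (f i)) ≡ ∑ (λ j → ∑ (λ i → f i j))
∑-swap {zero} {l} f = sym (∑-zero {l} _ (λ _ → refl))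
∑-swap {suc k} f = trans (cong (∑ (f zero) +_) (∑-swap (f ∘ suc))) (sym (∑-+ (f zero) _))

∑-single : ∀ {k} (i : Fin k) (f : Fin k → ℚ) → (∀ j → j ≢ i → f j ≡ 0ℚ) → ∑ f ≡ f i
∑-single zero f e = trans (cong (f zero +_) (∑-zero (f ∘ suc) (λ j → e (suc j) λ ()))) (QP.+-identityʳ _)
∑-single (suc i) f e = trans (cong₂ _+_ (e zero λ ()) (∑-single i (f ∘ suc) (λ j j≢i → e (suc j) (j≢i ∘ FP.suc-injective))))
                             (QP.+-identityˡ _)

∑-punchIn : ∀ {k} (i : Fin (suc k)) (f : Fin (suc k) → ℚ) → ∑ f ≡ f i + ∑ (f ∘ punchIn i)
∑-punchIn zero f = refl
∑-punchIn {suc k} (suc i) f = trans (cong (f zero +_) (∑-punchIn i (f ∘ suc)))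
  (solve 3 (λ a b c → a :+ (b :+ c) := b :+ (a :+ c)) refl (f zero) (f (suc i)) _)

∑-nonNeg : ∀ {k} (f : Fin k → ℚ) → (∀ i → 0ℚ ≤ f i) → 0ℚ ≤ ∑ f
∑-nonNeg {zero} f h = QP.≤-refl
∑-nonNeg {suc k} f h = QP.+-mono-≤ (h zero) (∑-nonNeg (f ∘ suc) (h ∘ suc))

∑-pos : ∀ {k} (f : Fin k → ℚ) → 0ℚ < ∑ f → ∃ λ i → 0ℚ < f i
∑-pos {zero} f 0<0 = ⊥-elim (QP.<-irrefl refl 0<0)
∑-pos {suc k} f 0<∑ with 0ℚ QP.<? f zero
... | yes 0<f0 = zero , 0<f0
... | no 0≮f0 = let i , 0<fi = ∑-pos (f ∘ suc) (QP.<-≤-trans 0<∑ ∑≤∑∘suc) in suc i , 0<fi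
  where
  ∑≤∑∘suc : ∑ f ≤ ∑ (f ∘ suc)
  ∑≤∑∘suc = subst (∑ f ≤_) (QP.+-identityˡ _) (QP.+-monoˡ-≤ (∑ (f ∘ suc)) (QP.≮⇒≥ 0≮f0))

δ : ∀ {k} → Fin k → Fin k → ℚ
δ i j with i F.≟ j
... | yes _ = 1ℚ
... | no _ = 0ℚ

δ-diag : ∀ {k} (i : Fin k) → δ i i ≡ 1ℚ
δ-diag i with i F.≟ i
... | yes _ = refl
... | no i≢i = ⊥-elim (i≢i refl)

δ-offdiag : ∀ {k} {i j : Fin k} → j ≢ i → δ i j ≡ 0ℚ
δ-offdiag {i = i} {j} j≢i with i F.≟ j
... | yes i≡j = ⊥-elim (j≢i (sym i≡j))
... | no _ = refl

δ-nonNeg : ∀ {k} (i j : Fin k) → 0ℚ ≤ δ i j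
δ-nonNeg i j with i F.≟ j
... | yes _ = QP.nonNegative⁻¹ 1ℚ
... | no _ = QP.≤-refl

∑-δ : ∀ {k} (i : Fin k) → ∑ (δ i) ≡ 1ℚ
∑-δ i = trans (∑-single i (δ i) (λ _ → δ-offdiag)) (δ-diag i)

∑-δ-* : ∀ {k} (i : Fin k) (f : Fin k → ℚ) → ∑ (λ j → δ i j * f j) ≡ f i
∑-δ-* i f = trans (∑-single i _ (λ j j≢i → trans (cong (_* f j) (δ-offdiag j≢i)) (QP.*-zeroˡ (f j))))
                  (trans (cong (_* f i) (δ-diag i)) (QP.*-identityˡ (f i)))

∑-difference-single : ∀ {k} (f g : Fin k → ℚ) i → (∀ l → l ≢ i → f l ≡ g l) → ∑ f - ∑ g ≡ f i - g i
∑-difference-single f g i f≡g = begin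
  ∑ f - ∑ g                    ≡⟨ cong (∑ f +_) (sym (∑-neg g)) ⟩
  ∑ f + ∑ (λ l → - g l)        ≡⟨ sym (∑-+ f (λ l → - g l)) ⟩
  ∑ (λ l → f l - g l)          ≡⟨ ∑-single i (λ l → f l - g l) (λ l l≢i →
                                    trans (cong (_- g l) (f≡g l l≢i)) (QP.+-inverseʳ (g l))) ⟩
  f i - g i ∎
  where open ≡-Reasoning

updateAt-∀ : ∀ {A : Set} {k} (P : A → Set) (f : Fin k → A) i {x} →
             (∀ l → P (f l)) → P x → ∀ l → P (updateAt f i (λ _ → x) l)
updateAt-∀ P f i Pf Px l with l F.≟ i
... | yes refl = subst P (sym (updateAt-updates l f)) Px
... | no l≢i = subst P (sym (updateAt-minimal l i f l≢i)) (Pf l)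

≡-by-lookup : ∀ {n} {u v : V n} → lookup u ≗ lookup v → u ≡ v
≡-by-lookup {u = u} {v} e = trans (sym (VP.tabulate∘lookup u)) (trans (VP.tabulate-cong e) (VP.tabulate∘lookup v))

lookup-+ᵥ : ∀ {n} (u v : V n) i → lookup (u +ᵥ v) i ≡ lookup u i + lookup v i
lookup-+ᵥ u v i = VP.lookup-zipWith _+_ i u v

lookup-• : ∀ {n} c (u : V n) i → lookup (c • u) i ≡ c * lookup u i
lookup-• c u i = VP.lookup-map i (c *_) u

lookup-negᵥ : ∀ {n} (u : V n) i → lookup (-ᵥ u) i ≡ - lookup u i
lookup-negᵥ u i = VP.lookup-map i -_ u

lookup-0ᵥ : ∀ {n} (i : Fin n) → lookup 0ᵥ i ≡ 0ℚ
lookup-0ᵥ i = VP.lookup-replicate i 0ℚ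

lookup--ᵥ : ∀ {n} (u v : V n) i → lookup (u -ᵥ v) i ≡ lookup u i - lookup v i
lookup--ᵥ u v i = trans (lookup-+ᵥ u (-ᵥ v) i) (cong (lookup u i +_) (lookup-negᵥ v i))

lookup-∑ᵥ : ∀ {n k} (f : Fin k → V n) i → lookup (∑ᵥ f) i ≡ ∑ (λ j → lookup (f j) i)
lookup-∑ᵥ {k = zero} f i = lookup-0ᵥ i
lookup-∑ᵥ {k = suc k} f i = trans (lookup-+ᵥ (f zero) _ i) (cong (lookup (f zero) i +_) (lookup-∑ᵥ (f ∘ suc) i))

lookup-∑ᵥ-• : ∀ {n k} (c : Fin k → ℚ) (v : Fin k → V n) i →
              lookup (∑ᵥ (λ j → c j • v j)) i ≡ ∑ (λ j → c j * lookup (v j) i)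
lookup-∑ᵥ-• c v i = trans (lookup-∑ᵥ (λ j → c j • v j) i) (∑-cong λ j → lookup-• (c j) (v j) i)

-ᵥ-inverseʳ : ∀ {n} (u : V n) → u -ᵥ u ≡ 0ᵥ
-ᵥ-inverseʳ u = ≡-by-lookup λ i → trans (lookup--ᵥ u u i) (trans (QP.+-inverseʳ (lookup u i)) (sym (lookup-0ᵥ i)))

-ᵥ≡0ᵥ⇒≡ : ∀ {n} {u v : V n} → u -ᵥ v ≡ 0ᵥ → u ≡ v
-ᵥ≡0ᵥ⇒≡ {u = u} {v} e = ≡-by-lookup λ i →
  x∙y⁻¹≈ε⇒x≈y _ _ (trans (sym (lookup--ᵥ u v i)) (trans (cong (λ w → lookup w i) e) (lookup-0ᵥ i)))

-ᵥ-1• : ∀ {n} (u v : V n) → u -ᵥ 1ℚ • v ≡ u -ᵥ v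
-ᵥ-1• u v = ≡-by-lookup λ i → trans (lookup--ᵥ u (1ℚ • v) i)
  (trans (cong (λ t → lookup u i - t) (trans (lookup-• 1ℚ v i) (QP.*-identityˡ (lookup v i)))) (sym (lookup--ᵥ u v i)))

-ᵥ-2• : ∀ {n} (u : V n) → u -ᵥ ℕ→ℚ 2 • u ≡ -ᵥ u
-ᵥ-2• u = ≡-by-lookup λ i → trans (lookup--ᵥ u (ℕ→ℚ 2 • u) i)
  (trans (cong (λ t → lookup u i - t) (lookup-• (ℕ→ℚ 2) u i)) (trans (solve 1 (λ a → a :- (con 1ℚ :+ con 1ℚ) :* a := :- a) refl (lookup u i)) (sym (lookup-negᵥ u i))))

-ᵥ-negᵥ : ∀ {n} (u v : V n) → u -ᵥ (-ᵥ v) ≡ u +ᵥ v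
-ᵥ-negᵥ u v = ≡-by-lookup λ i → trans (lookup--ᵥ u (-ᵥ v) i) (trans (cong (λ t → lookup u i - t) (lookup-negᵥ v i))
  (trans (solve 2 (λ a b → a :- (:- b) := a :+ b) refl (lookup u i) (lookup v i)) (sym (lookup-+ᵥ u v i))))

negᵥ--ᵥ : ∀ {n} (u v : V n) → -ᵥ (u -ᵥ v) ≡ v -ᵥ u
negᵥ--ᵥ u v = ≡-by-lookup λ i → trans (lookup-negᵥ (u -ᵥ v) i) (trans (cong -_ (lookup--ᵥ u v i))
  (trans (solve 2 (λ a b → :- (a :- b) := b :- a) refl (lookup u i) (lookup v i)) (sym (lookup--ᵥ v u i))))

+ᵥ--ᵥ-cancel : ∀ {n} (u v : V n) → (u +ᵥ v) -ᵥ v ≡ u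
+ᵥ--ᵥ-cancel u v = ≡-by-lookup λ i → trans (lookup--ᵥ (u +ᵥ v) v i) (trans (cong (_- lookup v i) (lookup-+ᵥ u v i))
  (solve 2 (λ a b → a :+ b :- b := a) refl (lookup u i) (lookup v i)))

-ᵥ-+ᵥ-cancel : ∀ {n} (u v : V n) → (u -ᵥ v) +ᵥ v ≡ u
-ᵥ-+ᵥ-cancel u v = ≡-by-lookup λ i → trans (lookup-+ᵥ (u -ᵥ v) v i) (trans (cong (_+ lookup v i) (lookup--ᵥ u v i))
  (solve 2 (λ a b → a :- b :+ b := a) refl (lookup u i) (lookup v i)))

+ᵥ-2•-cancel : ∀ {n} (u v : V n) → (u +ᵥ v) -ᵥ ℕ→ℚ 2 • v ≡ u -ᵥ v
+ᵥ-2•-cancel u v = ≡-by-lookup λ i → begin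
  lookup ((u +ᵥ v) -ᵥ ℕ→ℚ 2 • v) i                   ≡⟨ lookup--ᵥ (u +ᵥ v) (ℕ→ℚ 2 • v) i ⟩
  lookup (u +ᵥ v) i - lookup (ℕ→ℚ 2 • v) i           ≡⟨ cong₂ _-_ (lookup-+ᵥ u v i) (lookup-• (ℕ→ℚ 2) v i) ⟩
  (lookup u i + lookup v i) - ℕ→ℚ 2 * lookup v i     ≡⟨ solve 2 (λ a b → (a :+ b) :- (con 1ℚ :+ con 1ℚ) :* b := a :- b) refl
                                                                (lookup u i) (lookup v i) ⟩
  lookup u i - lookup v i                            ≡⟨ sym (lookup--ᵥ u v i) ⟩
  lookup (u -ᵥ v) i ∎
  where open ≡-Reasoning

∑ᵥ-cong : ∀ {n k} {f g : Fin k → V n} → (∀ j → f j ≡ g j) → ∑ᵥ f ≡ ∑ᵥ g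
∑ᵥ-cong {k = zero} e = refl
∑ᵥ-cong {k = suc k} e = cong₂ _+ᵥ_ (e zero) (∑ᵥ-cong (e ∘ suc))

module InnerProduct {n} (G : Gram n) (G-sym : ∀ i j → G i j ≡ G j i) where

  ⟪_,_⟫ : V n → V n → ℚ
  ⟪ x , y ⟫ = ⟪ x , y ⟫[ G ]

  private
    summand : V n → V n → Fin n → Fin n → ℚ
    summand x y i j = lookup x i * G i j * lookup y j

  ip-+ˡ : ∀ u v y → ⟪ u +ᵥ v , y ⟫ ≡ ⟪ u , y ⟫ + ⟪ v , y ⟫
  ip-+ˡ u v y = trans (∑-cong λ i → trans (∑-cong (term i)) (∑-+ (summand u y i) (summand v y i)))
                      (∑-+ (∑ ∘ summand u y) (∑ ∘ summand v y))
    where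
    term : ∀ i j → lookup (u +ᵥ v) i * G i j * lookup y j ≡ lookup u i * G i j * lookup y j + lookup v i * G i j * lookup y j
    term i j = trans (cong (λ t → t * G i j * lookup y j) (lookup-+ᵥ u v i))
      (solve 4 (λ a b g c → (a :+ b) :* g :* c := a :* g :* c :+ b :* g :* c) refl (lookup u i) (lookup v i) (G i j) (lookup y j))

  ip-•ˡ : ∀ c u y → ⟪ c • u , y ⟫ ≡ c * ⟪ u , y ⟫
  ip-•ˡ c u y = trans (∑-cong λ i → trans (∑-cong (term i)) (∑-* c (summand u y i))) (∑-* c (∑ ∘ summand u y))
    where
    term : ∀ i j → lookup (c • u) i * G i j * lookup y j ≡ c * (lookup u i * G i j * lookup y j)
    term i j = trans (cong (λ t → t * G i j * lookup y j) (lookup-• c u i))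
      (solve 4 (λ c a g b → c :* a :* g :* b := c :* (a :* g :* b)) refl c (lookup u i) (G i j) (lookup y j))

  ip-negˡ : ∀ u y → ⟪ -ᵥ u , y ⟫ ≡ - ⟪ u , y ⟫
  ip-negˡ u y = trans (∑-cong λ i → trans (∑-cong (term i)) (∑-neg (summand u y i))) (∑-neg (∑ ∘ summand u y))
    where
    term : ∀ i j → lookup (-ᵥ u) i * G i j * lookup y j ≡ - (lookup u i * G i j * lookup y j)
    term i j = trans (cong (λ t → t * G i j * lookup y j) (lookup-negᵥ u i))
      (solve 3 (λ a g b → (:- a) :* g :* b := :- (a :* g :* b)) refl (lookup u i) (G i j) (lookup y j))

  ip-0ˡ : ∀ y → ⟪ 0ᵥ , y ⟫ ≡ 0ℚ
  ip-0ˡ y = ∑-zero _ λ i → ∑-zero _ λ j → trans (cong (λ t → t * G i j * lookup y j) (lookup-0ᵥ i))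
    (solve 2 (λ g b → con 0ℚ :* g :* b := con 0ℚ) refl (G i j) (lookup y j))

  ip--ˡ : ∀ u v y → ⟪ u -ᵥ v , y ⟫ ≡ ⟪ u , y ⟫ - ⟪ v , y ⟫
  ip--ˡ u v y = trans (ip-+ˡ u (-ᵥ v) y) (cong (⟪ u , y ⟫ +_) (ip-negˡ v y))

  ip-∑ˡ : ∀ {k} (f : Fin k → V n) y → ⟪ ∑ᵥ f , y ⟫ ≡ ∑ (λ j → ⟪ f j , y ⟫)
  ip-∑ˡ {zero} f y = ip-0ˡ y
  ip-∑ˡ {suc k} f y = trans (ip-+ˡ (f zero) (∑ᵥ (f ∘ suc)) y) (cong (⟪ f zero , y ⟫ +_) (ip-∑ˡ (f ∘ suc) y))

  ip-∑•ˡ : ∀ {k} (c : Fin k → ℚ) (f : Fin k → V n) y →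
           ⟪ ∑ᵥ (λ j → c j • f j) , y ⟫ ≡ ∑ (λ j → c j * ⟪ f j , y ⟫)
  ip-∑•ˡ c f y = trans (ip-∑ˡ (λ j → c j • f j) y) (∑-cong λ j → ip-•ˡ (c j) (f j) y)

  ip-sym : ∀ x y → ⟪ x , y ⟫ ≡ ⟪ y , x ⟫
  ip-sym x y = trans (∑-swap (summand x y)) (∑-cong λ j → ∑-cong λ i →
    trans (cong (λ g → lookup x i * g * lookup y j) (G-sym i j))
          (solve 3 (λ a g b → a :* g :* b := b :* g :* a) refl (lookup x i) (G j i) (lookup y j)))

  ip-negʳ : ∀ y u → ⟪ y , -ᵥ u ⟫ ≡ - ⟪ y , u ⟫
  ip-negʳ y u = trans (ip-sym y (-ᵥ u)) (trans (ip-negˡ u y) (cong -_ (ip-sym u y)))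

  ip--ʳ : ∀ y u v → ⟪ y , u -ᵥ v ⟫ ≡ ⟪ y , u ⟫ - ⟪ y , v ⟫
  ip--ʳ y u v = trans (ip-sym y (u -ᵥ v)) (trans (ip--ˡ u v y) (cong₂ _-_ (ip-sym u y) (ip-sym v y)))

  ip-∑•ʳ : ∀ {k} y (c : Fin k → ℚ) (f : Fin k → V n) →
           ⟪ y , ∑ᵥ (λ j → c j • f j) ⟫ ≡ ∑ (λ j → c j * ⟪ y , f j ⟫)
  ip-∑•ʳ y c f = trans (ip-sym y (∑ᵥ (λ j → c j • f j)))
                       (trans (ip-∑•ˡ c f y) (∑-cong λ j → cong (c j *_) (ip-sym (f j) y)))

  ip-norm²-- : ∀ x y → ⟪ x -ᵥ y , x -ᵥ y ⟫ ≡ (⟪ x , x ⟫ - ⟪ x , y ⟫) + (⟪ y , y ⟫ - ⟪ x , y ⟫)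
  ip-norm²-- x y = begin
    ⟪ x -ᵥ y , x -ᵥ y ⟫                                   ≡⟨ ip--ˡ x y (x -ᵥ y) ⟩
    ⟪ x , x -ᵥ y ⟫ - ⟪ y , x -ᵥ y ⟫                       ≡⟨ cong₂ _-_ (ip--ʳ x x y) (ip--ʳ y x y) ⟩
    (⟪ x , x ⟫ - ⟪ x , y ⟫) - (⟪ y , x ⟫ - ⟪ y , y ⟫)
      ≡⟨ cong (λ t → (⟪ x , x ⟫ - ⟪ x , y ⟫) - (t - ⟪ y , y ⟫)) (ip-sym y x) ⟩
    (⟪ x , x ⟫ - ⟪ x , y ⟫) - (⟪ x , y ⟫ - ⟪ y , y ⟫)
      ≡⟨ solve 3 (λ a b c → (a :- b) :- (b :- c) := (a :- b) :+ (c :- b)) refl ⟪ x , x ⟫ ⟪ x , y ⟫ ⟪ y , y ⟫ ⟩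
    (⟪ x , x ⟫ - ⟪ x , y ⟫) + (⟪ y , y ⟫ - ⟪ x , y ⟫) ∎
    where open ≡-Reasoning

-- Linear dependence

NontrivialRelation : ∀ {k m} → (Fin k → Fin m → ℚ) → Set
NontrivialRelation {k} v = Σ (Fin k → ℚ) λ c → (∃ λ i → c i ≢ 0ℚ) × (∀ x → ∑ (λ i → c i * v i x) ≡ 0ℚ)

relation-zero-column : ∀ {k m} (v : Fin (suc k) → Fin (suc m) → ℚ) → (∀ i → v i zero ≡ 0ℚ) →
                       NontrivialRelation (λ i x → v (suc i) (suc x)) → NontrivialRelation v
relation-zero-column v zero-column (c , (i₀ , cᵢ₀≢0) , relation) = insertAt c zero 0ℚ , (suc i₀ , cᵢ₀≢0) , sums
  where
  sums : ∀ x → 0ℚ * v zero x + ∑ (λ i → c i * v (suc i) x) ≡ 0ℚ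
  sums x = trans (cong (_+ rest x) (QP.*-zeroˡ (v zero x))) (trans (QP.+-identityˡ (rest x)) (rest≡0 x))
    where
    rest : ∀ x → ℚ
    rest x = ∑ (λ i → c i * v (suc i) x)
    rest≡0 : ∀ x → rest x ≡ 0ℚ
    rest≡0 zero = ∑-zero _ λ i → trans (cong (c i *_) (zero-column (suc i))) (QP.*-zeroʳ (c i))
    rest≡0 (suc y) = relation y

module Elimination {k m} (v : Fin (suc k) → Fin (suc m) → ℚ) (j : Fin (suc k)) (pivot : v j zero ≢ 0ℚ) where

  private
    instance _ = Q.≢-nonZero pivot

  ratio : Fin k → ℚ
  ratio i = v (punchIn j i) zero * Q.1/ v j zero

  eliminated : Fin k → Fin m → ℚ
  eliminated i y = v (punchIn j i) (suc y) - ratio i * v j (suc y)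

  relation-pivot : NontrivialRelation eliminated → NontrivialRelation v
  relation-pivot (c , (i₀ , cᵢ₀≢0) , relation) = c′ , (punchIn j i₀ , nontrivial) , sums
    where
    s = - ∑ (λ i → c i * ratio i)
    c′ = insertAt c j s
    nontrivial : c′ (punchIn j i₀) ≢ 0ℚ
    nontrivial e = cᵢ₀≢0 (trans (sym (insertAt-punchIn c j s i₀)) e)
    expand : ∀ x → ∑ (λ l → c′ l * v l x) ≡ ∑ (λ i → c i * (v (punchIn j i) x - ratio i * v j x))
    expand x = begin
      ∑ (λ l → c′ l * v l x)
        ≡⟨ ∑-punchIn j (λ l → c′ l * v l x) ⟩
      c′ j * v j x + ∑ (λ i → c′ (punchIn j i) * v (punchIn j i) x)
        ≡⟨ cong₂ _+_ (cong (_* v j x) (insertAt-lookup c j s)) (∑-cong λ i → cong (_* v (punchIn j i) x) (insertAt-punchIn c j s i)) ⟩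
      s * v j x + b
        ≡⟨ solve 3 (λ s a b → :- s :* a :+ b := b :+ a :* (:- s)) refl (∑ (λ i → c i * ratio i)) (v j x) b ⟩
      b + v j x * - ∑ (λ i → c i * ratio i)
        ≡⟨ cong (λ t → b + v j x * t) (sym (∑-neg (λ i → c i * ratio i))) ⟩
      b + v j x * ∑ (λ i → - (c i * ratio i))
        ≡⟨ cong (b +_) (sym (∑-* (v j x) (λ i → - (c i * ratio i)))) ⟩
      b + ∑ (λ i → v j x * - (c i * ratio i))
        ≡⟨ sym (∑-+ (λ i → c i * v (punchIn j i) x) (λ i → v j x * - (c i * ratio i))) ⟩
      ∑ (λ i → c i * v (punchIn j i) x + v j x * - (c i * ratio i))
        ≡⟨ ∑-cong (λ i → solve 4 (λ c b a r → c :* b :+ a :* (:- (c :* r)) := c :* (b :- r :* a)) refl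
                                   (c i) (v (punchIn j i) x) (v j x) (ratio i)) ⟩
      ∑ (λ i → c i * (v (punchIn j i) x - ratio i * v j x)) ∎
      where
      open ≡-Reasoning
      b = ∑ (λ i → c i * v (punchIn j i) x)
    first-column : ∀ i → v (punchIn j i) zero - ratio i * v j zero ≡ 0ℚ
    first-column i = begin
      a - a * Q.1/ v j zero * v j zero   ≡⟨ cong (λ t → a - t) (QP.*-assoc a _ (v j zero)) ⟩
      a - a * (Q.1/ v j zero * v j zero) ≡⟨ cong (λ t → a - a * t) (QP.*-inverseˡ (v j zero)) ⟩
      a - a * 1ℚ                         ≡⟨ solve 1 (λ a → a :- a :* con 1ℚ := con 0ℚ) refl a ⟩
      0ℚ ∎
      where
      open ≡-Reasoning
      a = v (punchIn j i) zero
    sums : ∀ x → ∑ (λ l → c′ l * v l x) ≡ 0ℚ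
    sums zero = trans (expand zero) (∑-zero _ λ i → trans (cong (c i *_) (first-column i)) (QP.*-zeroʳ (c i)))
    sums (suc y) = trans (expand (suc y)) (relation y)

open Elimination using (eliminated; relation-pivot)

dependent : ∀ k (v : Fin (suc k) → Fin k → ℚ) → NontrivialRelation v
dependent zero v = (λ _ → 1ℚ) , (zero , λ ()) , λ ()
dependent (suc k) v with FP.any? (λ j → ¬? (v j zero QP.≟ 0ℚ))
... | yes (j , pivot) = relation-pivot v j pivot (dependent k (eliminated v j pivot))
... | no no-pivot = relation-zero-column v zero-column (dependent k (λ i x → v (suc i) (suc x)))
  where
  zero-column : ∀ i → v i zero ≡ 0ℚ
  zero-column i = decidable-stable (v i zero QP.≟ 0ℚ) (λ vᵢ₀≢0 → no-pivot (i , vᵢ₀≢0))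

hyperplane-¬AffIndep : ∀ {n} (G : Gram n) → (∀ i j → G i j ≡ G j i) → ∀ {a ω : V n} {q} → ⟪ a , ω ⟫[ G ] ≡ 1ℚ →
                       (p : Fin (suc n) → V n) → (∀ i → ⟪ p i , ω ⟫[ G ] ≡ q) → ¬ AffIndep p
hyperplane-¬AffIndep {n} G G-sym {a} {ω} {q} a·ω≡1 p p·ω≡q affIndep = absurd (dependent n (λ l x → lookup (u l) x))
  where
  open InnerProduct G G-sym
  edge : Fin n → V n
  edge i = p (suc i) -ᵥ p zero
  u : Fin (suc n) → V n
  u zero = a
  u (suc i) = edge i
  edge·ω≡0 : ∀ i → ⟪ edge i , ω ⟫ ≡ 0ℚ
  edge·ω≡0 i = trans (ip--ˡ (p (suc i)) (p zero) ω) (trans (cong₂ _-_ (p·ω≡q (suc i)) (p·ω≡q zero)) (QP.+-inverseʳ q))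
  absurd : NontrivialRelation (λ l x → lookup (u l) x) → ⊥
  absurd (c , (i₀ , cᵢ₀≢0) , relation) = cᵢ₀≢0 (c≡0 i₀)
    where
    combination : ∑ᵥ (λ l → c l • u l) ≡ 0ᵥ
    combination = ≡-by-lookup λ x → trans (lookup-∑ᵥ-• c u x) (trans (relation x) (sym (lookup-0ᵥ x)))
    c₀≡0 : c zero ≡ 0ℚ
    c₀≡0 = begin
      c zero                                 ≡⟨ sym (QP.*-identityʳ (c zero)) ⟩
      c zero * 1ℚ                            ≡⟨ cong (c zero *_) (sym a·ω≡1) ⟩
      c zero * ⟪ a , ω ⟫                     ≡⟨ sym (QP.+-identityʳ _) ⟩
      c zero * ⟪ a , ω ⟫ + 0ℚ                ≡⟨ cong (c zero * ⟪ a , ω ⟫ +_) (sym (∑-zero _ λ i →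
                                                  trans (cong (c (suc i) *_) (edge·ω≡0 i)) (QP.*-zeroʳ (c (suc i))))) ⟩
      ∑ (λ l → c l * ⟪ u l , ω ⟫)            ≡⟨ sym (ip-∑•ˡ c u ω) ⟩
      ⟪ ∑ᵥ (λ l → c l • u l) , ω ⟫           ≡⟨ cong ⟪_, ω ⟫ combination ⟩
      ⟪ 0ᵥ , ω ⟫                             ≡⟨ ip-0ˡ ω ⟩
      0ℚ ∎
      where open ≡-Reasoning
    edges-relation : ∑ᵥ (λ i → c (suc i) • edge i) ≡ 0ᵥ
    edges-relation = ≡-by-lookup λ x → begin
      lookup (∑ᵥ (λ i → c (suc i) • edge i)) x                         ≡⟨ lookup-∑ᵥ-• (c ∘ suc) edge x ⟩
      ∑ (λ i → c (suc i) * lookup (edge i) x)                          ≡⟨ sym (QP.+-identityˡ _) ⟩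
      0ℚ + ∑ (λ i → c (suc i) * lookup (edge i) x)                     ≡⟨ cong (_+ ∑ (λ i → c (suc i) * lookup (edge i) x))
                                                                            (sym (trans (cong (_* lookup a x) c₀≡0) (QP.*-zeroˡ (lookup a x)))) ⟩
      c zero * lookup a x + ∑ (λ i → c (suc i) * lookup (edge i) x)    ≡⟨ relation x ⟩
      0ℚ                                                               ≡⟨ sym (lookup-0ᵥ x) ⟩
      lookup 0ᵥ x ∎
      where open ≡-Reasoning
    c≡0 : ∀ l → c l ≡ 0ℚ
    c≡0 zero = c₀≡0
    c≡0 (suc i) = affIndep (c ∘ suc) edges-relation i

LinIndep-cong : ∀ {n k} {u v : Fin k → V n} → (∀ i → u i ≡ v i) → LinIndep u → LinIndep v
LinIndep-cong u≡v indep c e = indep c (trans (∑ᵥ-cong λ i → cong (c i •_) (u≡v i)) e)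

LinIndep-punchIn : ∀ {n k} {v : Fin (suc k) → V n} (j : Fin (suc k)) → LinIndep v → LinIndep (v ∘ punchIn j)
LinIndep-punchIn {v = v} j indep c e i = trans (sym (insertAt-punchIn c j 0ℚ i)) (indep c′ e′ (punchIn j i))
  where
  c′ = insertAt c j 0ℚ
  e′ : ∑ᵥ (λ l → c′ l • v l) ≡ 0ᵥ
  e′ = ≡-by-lookup λ x → begin
    lookup (∑ᵥ (λ l → c′ l • v l)) x
      ≡⟨ lookup-∑ᵥ-• c′ v x ⟩
    ∑ (λ l → c′ l * lookup (v l) x)
      ≡⟨ ∑-punchIn j (λ l → c′ l * lookup (v l) x) ⟩
    c′ j * lookup (v j) x + ∑ (λ i → c′ (punchIn j i) * lookup (v (punchIn j i)) x)
      ≡⟨ cong₂ _+_ (trans (cong (_* lookup (v j) x) (insertAt-lookup c j 0ℚ)) (QP.*-zeroˡ (lookup (v j) x)))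
                   (∑-cong λ i → cong (_* lookup (v (punchIn j i)) x) (insertAt-punchIn c j 0ℚ i)) ⟩
    0ℚ + ∑ (λ i → c i * lookup (v (punchIn j i)) x)
      ≡⟨ QP.+-identityˡ _ ⟩
    ∑ (λ i → c i * lookup (v (punchIn j i)) x)
      ≡⟨ sym (lookup-∑ᵥ-• c (v ∘ punchIn j) x) ⟩
    lookup (∑ᵥ (λ i → c i • v (punchIn j i))) x
      ≡⟨ cong (λ w → lookup w x) e ⟩
    lookup 0ᵥ x ∎
    where open ≡-Reasoning

LinIndep-• : ∀ {n k} {v : Fin k → V n} {r} → 0ℚ < r → LinIndep v → LinIndep (λ i → r • v i)
LinIndep-• {v = v} {r} 0<r indep c e i = *-cancelʳ-pos 0<r (trans (indep (λ j → c j * r) e′ i) (sym (QP.*-zeroˡ r)))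
  where
  e′ : ∑ᵥ (λ j → (c j * r) • v j) ≡ 0ᵥ
  e′ = trans (≡-by-lookup λ x → trans (lookup-∑ᵥ-• (λ j → c j * r) v x) (trans
         (∑-cong λ j → trans (QP.*-assoc (c j) r (lookup (v j) x)) (cong (c j *_) (sym (lookup-• r (v j) x))))
         (sym (lookup-∑ᵥ-• c (λ j → r • v j) x)))) e

module Cone {n} (Φ : List (V n)) where

  -- nonnegative combinations of Φ with total weight w, so that InConv Φ x is InCone x 1ℚ
  InCone : V n → ℚ → Set
  InCone x w = Σ (Fin (length Φ) → ℚ) λ c → (∀ j → 0ℚ ≤ c j) × (∑ c ≡ w) × (∑ᵥ (λ j → c j • root Φ j) ≡ x)

  root-InCone : ∀ {β} → β ∈ Φ → InCone β 1ℚ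
  root-InCone β∈Φ = δ i , δ-nonNeg i , ∑-δ i , ≡-by-lookup λ x →
    trans (lookup-∑ᵥ-• (δ i) (root Φ) x) (trans (∑-δ-* i _) (cong (λ β → lookup β x) (sym (AnyP.lookup-index β∈Φ))))
    where i = Any.index β∈Φ

  InCone-0 : InCone 0ᵥ 0ℚ
  InCone-0 = (λ _ → 0ℚ) , (λ _ → QP.≤-refl) , ∑-zero {length Φ} _ (λ _ → refl) , ≡-by-lookup λ x →
    trans (lookup-∑ᵥ-• (λ _ → 0ℚ) (root Φ) x) (trans (∑-zero _ λ j → QP.*-zeroˡ (lookup (root Φ j) x)) (sym (lookup-0ᵥ x)))

  InCone-+ : ∀ {x y w w′} → InCone x w → InCone y w′ → InCone (x +ᵥ y) (w + w′)
  InCone-+ {x} {y} (c , c≥0 , ∑c , cx) (d , d≥0 , ∑d , dy) =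
    (λ j → c j + d j) , (λ j → QP.+-mono-≤ (c≥0 j) (d≥0 j)) , trans (∑-+ c d) (cong₂ _+_ ∑c ∑d) , ≡-by-lookup λ l → begin
      lookup (∑ᵥ (λ j → (c j + d j) • root Φ j)) l
        ≡⟨ lookup-∑ᵥ-• (λ j → c j + d j) (root Φ) l ⟩
      ∑ (λ j → (c j + d j) * lookup (root Φ j) l)
        ≡⟨ ∑-cong (λ j → QP.*-distribʳ-+ (lookup (root Φ j) l) (c j) (d j)) ⟩
      ∑ (λ j → c j * lookup (root Φ j) l + d j * lookup (root Φ j) l)
        ≡⟨ ∑-+ (λ j → c j * lookup (root Φ j) l) (λ j → d j * lookup (root Φ j) l) ⟩
      ∑ (λ j → c j * lookup (root Φ j) l) + ∑ (λ j → d j * lookup (root Φ j) l)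
        ≡⟨ sym (cong₂ _+_ (lookup-∑ᵥ-• c (root Φ) l) (lookup-∑ᵥ-• d (root Φ) l)) ⟩
      lookup (∑ᵥ (λ j → c j • root Φ j)) l + lookup (∑ᵥ (λ j → d j • root Φ j)) l
        ≡⟨ cong₂ (λ s t → lookup s l + lookup t l) cx dy ⟩
      lookup x l + lookup y l
        ≡⟨ sym (lookup-+ᵥ x y l) ⟩
      lookup (x +ᵥ y) l ∎
    where open ≡-Reasoning

  InCone-• : ∀ {x w} t → 0ℚ ≤ t → InCone x w → InCone (t • x) (t * w)
  InCone-• {x} t t≥0 (c , c≥0 , ∑c , cx) =
    (λ j → t * c j) , (λ j → *-nonNeg t≥0 (c≥0 j)) , trans (∑-* t c) (cong (t *_) ∑c) , ≡-by-lookup λ l → begin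
      lookup (∑ᵥ (λ j → (t * c j) • root Φ j)) l   ≡⟨ lookup-∑ᵥ-• (λ j → t * c j) (root Φ) l ⟩
      ∑ (λ j → t * c j * lookup (root Φ j) l)      ≡⟨ ∑-cong (λ j → QP.*-assoc t (c j) (lookup (root Φ j) l)) ⟩
      ∑ (λ j → t * (c j * lookup (root Φ j) l))    ≡⟨ ∑-* t (λ j → c j * lookup (root Φ j) l) ⟩
      t * ∑ (λ j → c j * lookup (root Φ j) l)      ≡⟨ cong (t *_) (sym (lookup-∑ᵥ-• c (root Φ) l)) ⟩
      t * lookup (∑ᵥ (λ j → c j • root Φ j)) l     ≡⟨ cong (λ s → t * lookup s l) cx ⟩
      t * lookup x l                               ≡⟨ sym (lookup-• t x l) ⟩
      lookup (t • x) l ∎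
    where open ≡-Reasoning

  InCone-∑ : ∀ {k} (x : Fin k → V n) (w : Fin k → ℚ) → (∀ l → InCone (x l) (w l)) → InCone (∑ᵥ x) (∑ w)
  InCone-∑ {zero} x w h = InCone-0
  InCone-∑ {suc k} x w h = InCone-+ (h zero) (InCone-∑ (x ∘ suc) (w ∘ suc) (h ∘ suc))

module RootSystem {n} (G : Gram n) (euc : IsEuclidean G) (Φ : List (V n)) (rs : IsRootSystem G Φ) where
  open InnerProduct G (proj₁ euc) public
  open IsRootSystem rs

  root≢0ᵥ : ∀ {β} → β ∈ Φ → β ≢ 0ᵥ
  root≢0ᵥ β∈Φ β≡0 = nonzero (subst (_∈ Φ) β≡0 β∈Φ)

  root-norm²-pos : ∀ {β} → β ∈ Φ → 0ℚ < ⟪ β , β ⟫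
  root-norm²-pos β∈Φ = proj₂ euc _ (root≢0ᵥ β∈Φ)

  reflection∈ : ∀ {α β} → α ∈ Φ → β ∈ Φ → ∀ q → ℕ→ℚ 2 * ⟪ β , α ⟫ ≡ q * ⟪ α , α ⟫ →
                (β -ᵥ q • α) ∈ Φ
  reflection∈ {α} {β} α∈Φ β∈Φ q e = subst (λ t → (β -ᵥ t • α) ∈ Φ) z≡q β-zα∈Φ
    where
    z = proj₁ (crystallographic α∈Φ β∈Φ)
    β-zα∈Φ = proj₂ (proj₂ (crystallographic α∈Φ β∈Φ))
    z≡q : ℤ→ℚ z ≡ q
    z≡q = *-cancelʳ-pos (root-norm²-pos α∈Φ) (trans (sym (proj₁ (proj₂ (crystallographic α∈Φ β∈Φ)))) e)

  negation∈ : ∀ {β} → β ∈ Φ → (-ᵥ β) ∈ Φ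
  negation∈ {β} β∈Φ = subst (_∈ Φ) (-ᵥ-2• β) (reflection∈ β∈Φ β∈Φ (ℕ→ℚ 2) refl)

  cartan-integer-1⊎≤ : ∀ z {B C} → 0ℚ < B → 0ℚ < C → ℕ→ℚ 2 * B ≡ ℤ→ℚ z * C → z ≡ ℤ.+ 1 ⊎ C ≤ B
  cartan-integer-1⊎≤ (ℤ.+ 0) {B} {C} 0<B _ e = ⊥-elim (QP.<-irrefl (sym (trans e (QP.*-zeroˡ C))) (*-pos (QP.positive⁻¹ (ℕ→ℚ 2)) 0<B))
  cartan-integer-1⊎≤ (ℤ.+ 1) _ _ _ = inj₁ refl
  cartan-integer-1⊎≤ (ℤ.+ suc (suc a)) {B} {C} _ 0<C e = inj₂ (QP.*-cancelˡ-≤-pos (ℕ→ℚ 2) (begin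
    ℕ→ℚ 2 * C                       ≤⟨ p≤p+q (ℕ→ℚ 2 * C) (*-nonNeg (ℕ→ℚ-nonNeg a) (QP.<⇒≤ 0<C)) ⟩
    ℕ→ℚ 2 * C + ℕ→ℚ a * C           ≡⟨ sym (QP.*-distribʳ-+ C (ℕ→ℚ 2) (ℕ→ℚ a)) ⟩
    (ℕ→ℚ 2 + ℕ→ℚ a) * C             ≡⟨ cong (_* C) (sym (ℕ→ℚ-+ 2 a)) ⟩
    ℕ→ℚ (2 ℕ.+ a) * C               ≡⟨ sym e ⟩
    ℕ→ℚ 2 * B ∎))
    where open QP.≤-Reasoning
  cartan-integer-1⊎≤ ℤ.-[1+ k ] {B} {C} 0<B 0<C e = ⊥-elim (QP.<-irrefl refl (begin-strict
    0ℚ                              <⟨ *-pos (QP.positive⁻¹ (ℕ→ℚ 2)) 0<B ⟩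
    ℕ→ℚ 2 * B                       ≡⟨ trans e (sym (QP.neg-distribˡ-* (ℕ→ℚ (suc k)) C)) ⟩
    - (ℕ→ℚ (suc k) * C)             ≤⟨ QP.neg-antimono-≤ (*-nonNeg (ℕ→ℚ-nonNeg (suc k)) (QP.<⇒≤ 0<C)) ⟩
    0ℚ ∎))
    where open QP.≤-Reasoning

  private
    cartan-one∈ : ∀ {β γ} z → z ≡ ℤ.+ 1 → (β -ᵥ ℤ→ℚ z • γ) ∈ Φ → (β -ᵥ γ) ∈ Φ
    cartan-one∈ {β} {γ} z z≡1 = subst (_∈ Φ) (trans (cong (λ t → β -ᵥ ℤ→ℚ t • γ) z≡1) (-ᵥ-1• β γ))

  norm²≤ip⇒≡ : ∀ {β γ} → ⟪ γ , γ ⟫ ≤ ⟪ β , γ ⟫ → ⟪ β , β ⟫ ≤ ⟪ β , γ ⟫ → β ≡ γ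
  norm²≤ip⇒≡ {β} {γ} γγ≤βγ ββ≤βγ = -ᵥ≡0ᵥ⇒≡ (decidable-stable (VP.≡-dec QP._≟_ (β -ᵥ γ) 0ᵥ) λ β-γ≢0 →
    QP.<-irrefl refl (begin-strict
      0ℚ                                                  <⟨ proj₂ euc _ β-γ≢0 ⟩
      ⟪ β -ᵥ γ , β -ᵥ γ ⟫                                 ≡⟨ ip-norm²-- β γ ⟩
      (⟪ β , β ⟫ - ⟪ β , γ ⟫) + (⟪ γ , γ ⟫ - ⟪ β , γ ⟫)   ≤⟨ QP.+-mono-≤ (p≤q⇒p-q≤0 ββ≤βγ) (p≤q⇒p-q≤0 γγ≤βγ) ⟩
      0ℚ + 0ℚ                                             ≡⟨ QP.+-identityˡ 0ℚ ⟩
      0ℚ ∎))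
    where open QP.≤-Reasoning

  -- Both Cartan integers 2⟪β,γ⟫/⟪γ,γ⟫ and 2⟪β,γ⟫/⟪β,β⟫ are positive; unless one of them is 1,
  -- both squared lengths are at most ⟪β,γ⟫, which forces β = γ.
  difference∈ : ∀ {β γ} → β ∈ Φ → γ ∈ Φ → 0ℚ < ⟪ β , γ ⟫ → β ≢ γ → (β -ᵥ γ) ∈ Φ
  difference∈ {β} {γ} β∈Φ γ∈Φ 0<βγ β≢γ = by-cases first second
    where
    z = proj₁ (crystallographic γ∈Φ β∈Φ)
    z′ = proj₁ (crystallographic β∈Φ γ∈Φ)
    first : z ≡ ℤ.+ 1 ⊎ ⟪ γ , γ ⟫ ≤ ⟪ β , γ ⟫
    first = cartan-integer-1⊎≤ z 0<βγ (root-norm²-pos γ∈Φ) (proj₁ (proj₂ (crystallographic γ∈Φ β∈Φ)))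
    second : z′ ≡ ℤ.+ 1 ⊎ ⟪ β , β ⟫ ≤ ⟪ β , γ ⟫
    second = cartan-integer-1⊎≤ z′ 0<βγ (root-norm²-pos β∈Φ)
                        (trans (cong (ℕ→ℚ 2 *_) (ip-sym β γ)) (proj₁ (proj₂ (crystallographic β∈Φ γ∈Φ))))
    by-cases : z ≡ ℤ.+ 1 ⊎ ⟪ γ , γ ⟫ ≤ ⟪ β , γ ⟫ → z′ ≡ ℤ.+ 1 ⊎ ⟪ β , β ⟫ ≤ ⟪ β , γ ⟫ → (β -ᵥ γ) ∈ Φ
    by-cases (inj₁ z≡1) _ = cartan-one∈ z z≡1 (proj₂ (proj₂ (crystallographic γ∈Φ β∈Φ)))
    by-cases _ (inj₁ z′≡1) =
      subst (_∈ Φ) (negᵥ--ᵥ γ β) (negation∈ (cartan-one∈ z′ z′≡1 (proj₂ (proj₂ (crystallographic β∈Φ γ∈Φ)))))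
    by-cases (inj₂ γγ≤βγ) (inj₂ ββ≤βγ) = ⊥-elim (β≢γ (norm²≤ip⇒≡ γγ≤βγ ββ≤βγ))

  sum∈ : ∀ {β γ} → β ∈ Φ → γ ∈ Φ → ⟪ β , γ ⟫ < 0ℚ → β ≢ -ᵥ γ → (β +ᵥ γ) ∈ Φ
  sum∈ {β} {γ} β∈Φ γ∈Φ βγ<0 β≢-γ =
    subst (_∈ Φ) (-ᵥ-negᵥ β γ)
          (difference∈ β∈Φ (negation∈ γ∈Φ) (subst (0ℚ <_) (sym (ip-negʳ β γ)) (QP.neg-antimono-< βγ<0)) β≢-γ)

module SimpleSystem {n} (G : Gram n) (euc : IsEuclidean G) (Φ : List (V n)) (rs : IsRootSystem G Φ)
                    (Π : Fin n → V n) (ss : IsSimpleSystem Φ Π) where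
  open RootSystem G euc Φ rs public
  open IsSimpleSystem ss

  _≟ᵥ_ : (u v : V n) → Dec (u ≡ v)
  _≟ᵥ_ = VP.≡-dec QP._≟_

  QComb : (Fin n → ℚ) → V n
  QComb c = ∑ᵥ (λ i → c i • Π i)

  QComb-cong : ∀ {c d} → c ≗ d → QComb c ≡ QComb d
  QComb-cong c≗d = ∑ᵥ-cong λ i → cong (_• Π i) (c≗d i)

  QComb--ᵥ : ∀ c d → QComb c -ᵥ QComb d ≡ QComb (λ i → c i - d i)
  QComb--ᵥ c d = ≡-by-lookup λ x → begin
    lookup (QComb c -ᵥ QComb d) x                                ≡⟨ lookup--ᵥ (QComb c) (QComb d) x ⟩
    lookup (QComb c) x - lookup (QComb d) x                      ≡⟨ cong₂ _-_ (lookup-∑ᵥ-• c Π x) (lookup-∑ᵥ-• d Π x) ⟩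
    ∑ (λ i → c i * lookup (Π i) x) - ∑ (λ i → d i * lookup (Π i) x)
      ≡⟨ cong (∑ (λ i → c i * lookup (Π i) x) +_) (sym (∑-neg (λ i → d i * lookup (Π i) x))) ⟩
    ∑ (λ i → c i * lookup (Π i) x) + ∑ (λ i → - (d i * lookup (Π i) x))
      ≡⟨ sym (∑-+ (λ i → c i * lookup (Π i) x) (λ i → - (d i * lookup (Π i) x))) ⟩
    ∑ (λ i → c i * lookup (Π i) x + - (d i * lookup (Π i) x))
      ≡⟨ ∑-cong (λ i → solve 3 (λ a b p → a :* p :+ (:- (b :* p)) := (a :- b) :* p) refl (c i) (d i) (lookup (Π i) x)) ⟩
    ∑ (λ i → (c i - d i) * lookup (Π i) x)                       ≡⟨ sym (lookup-∑ᵥ-• (λ i → c i - d i) Π x) ⟩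
    lookup (QComb (λ i → c i - d i)) x ∎
    where open ≡-Reasoning

  QComb-negᵥ : ∀ c → -ᵥ QComb c ≡ QComb (λ i → - c i)
  QComb-negᵥ c = ≡-by-lookup λ x → begin
    lookup (-ᵥ QComb c) x                   ≡⟨ lookup-negᵥ (QComb c) x ⟩
    - lookup (QComb c) x                    ≡⟨ cong -_ (lookup-∑ᵥ-• c Π x) ⟩
    - ∑ (λ i → c i * lookup (Π i) x)        ≡⟨ sym (∑-neg (λ i → c i * lookup (Π i) x)) ⟩
    ∑ (λ i → - (c i * lookup (Π i) x))      ≡⟨ ∑-cong (λ i → QP.neg-distribˡ-* (c i) (lookup (Π i) x)) ⟩
    ∑ (λ i → - c i * lookup (Π i) x)        ≡⟨ sym (lookup-∑ᵥ-• (λ i → - c i) Π x) ⟩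
    lookup (QComb (λ i → - c i)) x ∎
    where open ≡-Reasoning

  QComb-injective : ∀ c d → QComb c ≡ QComb d → ∀ i → c i ≡ d i
  QComb-injective c d e i = x∙y⁻¹≈ε⇒x≈y (c i) (d i) (indep (λ j → c j - d j) c-d≡0 i)
    where
    c-d≡0 : QComb (λ j → c j - d j) ≡ 0ᵥ
    c-d≡0 = trans (sym (QComb--ᵥ c d)) (trans (cong (_-ᵥ QComb d) e) (-ᵥ-inverseʳ (QComb d)))

  Π≡QComb-δ : ∀ i → Π i ≡ QComb (δ i)
  Π≡QComb-δ i = sym (≡-by-lookup λ x → trans (lookup-∑ᵥ-• (δ i) Π x) (∑-δ-* i (λ j → lookup (Π j) x)))

  Π-injective : ∀ {i j} → Π i ≡ Π j → i ≡ j
  Π-injective {i} {j} Πᵢ≡Πⱼ = decidable-stable (i F.≟ j) λ i≢j →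
    QP.1≢0 (trans (sym (δ-diag i)) (trans (QComb-injective (δ i) (δ j) δᵢ≡δⱼ i) (δ-offdiag i≢j)))
    where
    δᵢ≡δⱼ : QComb (δ i) ≡ QComb (δ j)
    δᵢ≡δⱼ = trans (sym (Π≡QComb-δ i)) (trans Πᵢ≡Πⱼ (Π≡QComb-δ j))

  ℕComb-nonNeg : ∀ c k → QComb c ≡ ℕComb Π k → ∀ i → 0ℚ ≤ c i
  ℕComb-nonNeg c k e i = subst (0ℚ ≤_) (sym (QComb-injective c (λ l → ℕ→ℚ (k l)) e i)) (ℕ→ℚ-nonNeg (k i))

  mixed-signs-¬root : ∀ c {i j} → QComb c ∈ Φ → 0ℚ < c i → c j < 0ℚ → ⊥
  mixed-signs-¬root c {i} {j} β∈Φ 0<cᵢ cⱼ<0 with signed β∈Φ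
  ... | k , inj₁ β≡k = QP.<-irrefl refl (QP.<-≤-trans cⱼ<0 (ℕComb-nonNeg c k β≡k j))
  ... | k , inj₂ β≡-k = QP.<-irrefl refl (QP.<-≤-trans 0<cᵢ (begin
    c i                  ≡⟨ QComb-injective c (λ l → - ℕ→ℚ (k l)) (trans β≡-k (QComb-negᵥ (λ l → ℕ→ℚ (k l)))) i ⟩
    - ℕ→ℚ (k i)          ≤⟨ QP.neg-antimono-≤ (ℕ→ℚ-nonNeg (k i)) ⟩
    0ℚ ∎))
    where open QP.≤-Reasoning

  simple-obtuse : ∀ {i j} → i ≢ j → ⟪ Π i , Π j ⟫ ≤ 0ℚ
  simple-obtuse {i} {j} i≢j = QP.≮⇒≥ λ 0<ΠᵢΠⱼ →
    mixed-signs-¬root (λ l → δ i l - δ j l) {i} {j}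
      (subst (_∈ Φ) Πᵢ-Πⱼ≡ (difference∈ (inΦ i) (inΦ j) 0<ΠᵢΠⱼ (i≢j ∘ Π-injective))) 0<cᵢ cⱼ<0
    where
    Πᵢ-Πⱼ≡ : Π i -ᵥ Π j ≡ QComb (λ l → δ i l - δ j l)
    Πᵢ-Πⱼ≡ = trans (cong₂ _-ᵥ_ (Π≡QComb-δ i) (Π≡QComb-δ j)) (QComb--ᵥ (δ i) (δ j))
    0<cᵢ : 0ℚ < δ i i - δ j i
    0<cᵢ = 0<1-0 (δ-diag i) (δ-offdiag i≢j)
    cⱼ<0 : δ i j - δ j j < 0ℚ
    cⱼ<0 = 0-1<0 (δ-offdiag (i≢j ∘ sym)) (δ-diag j)

  acute-simple-in-support : ∀ {k} → ℕComb Π k ∈ Φ → ∃ λ i → 0 ℕ.< k i × 0ℚ < ⟪ ℕComb Π k , Π i ⟫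
  acute-simple-in-support {k} β∈Φ = positive-summand (∑-pos (λ i → ℕ→ℚ (k i) * ⟪ ℕComb Π k , Π i ⟫)
                      (subst (0ℚ <_) (ip-∑•ʳ (ℕComb Π k) (λ i → ℕ→ℚ (k i)) Π) (root-norm²-pos β∈Φ)))
    where
    positive-summand : (∃ λ i → 0ℚ < ℕ→ℚ (k i) * ⟪ ℕComb Π k , Π i ⟫) →
                       ∃ λ i → 0 ℕ.< k i × 0ℚ < ⟪ ℕComb Π k , Π i ⟫
    positive-summand (i , 0<kᵢβΠᵢ) = i , 0<ℕ→ℚ*⇒0< (k i) ⟪ ℕComb Π k , Π i ⟫ 0<kᵢβΠᵢ
                                       , 0<*⇒0<ʳ {ℕ→ℚ (k i)} {⟪ ℕComb Π k , Π i ⟫} (ℕ→ℚ-nonNeg (k i)) 0<kᵢβΠᵢ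

  ℕComb-pred : ∀ k i → 0 ℕ.< k i → ℕComb Π k -ᵥ Π i ≡ ℕComb Π (updateAt k i ℕ.pred)
  ℕComb-pred k i 0<kᵢ =
    trans (cong (λ v → ℕComb Π k -ᵥ v) (Π≡QComb-δ i)) (trans (QComb--ᵥ (λ j → ℕ→ℚ (k j)) (δ i)) (QComb-cong coefficient))
    where
    coefficient : ∀ j → ℕ→ℚ (k j) - δ i j ≡ ℕ→ℚ (updateAt k i ℕ.pred j)
    coefficient j with j F.≟ i
    ... | no j≢i = trans (cong (λ t → ℕ→ℚ (k j) - t) (δ-offdiag j≢i))
                         (trans (p-0≡p (ℕ→ℚ (k j))) (cong ℕ→ℚ (sym (updateAt-minimal j i k j≢i))))
    ... | yes refl = trans (cong (λ t → ℕ→ℚ (k i) - t) (δ-diag i))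
                           (trans (sym (ℕ→ℚ-pred 0<kᵢ)) (cong ℕ→ℚ (sym (updateAt-updates i k))))

  orthogonal-extension-¬root : ∀ {k} i → ℕComb Π k ∈ Φ → k i ≡ 0 →
                               (∀ l → 0 ℕ.< k l → ⟪ Π l , Π i ⟫ ≡ 0ℚ) → ¬ (ℕComb Π k +ᵥ Π i) ∈ Φ
  orthogonal-extension-¬root {k} i β∈Φ kᵢ≡0 orth β+Πᵢ∈Φ = mixed-signs (acute-simple-in-support β∈Φ)
    where
    β = ℕComb Π k
    c : Fin n → ℚ
    c j = ℕ→ℚ (k j) - δ i j
    β⊥Πᵢ : ⟪ β , Π i ⟫ ≡ 0ℚ
    β⊥Πᵢ = trans (ip-∑•ˡ (λ l → ℕ→ℚ (k l)) Π (Π i)) (∑-zero _ term≡0)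
      where
      term≡0 : ∀ l → ℕ→ℚ (k l) * ⟪ Π l , Π i ⟫ ≡ 0ℚ
      term≡0 l with 0 ℕ.<? k l
      ... | yes 0<kₗ = trans (cong (ℕ→ℚ (k l) *_) (orth l 0<kₗ)) (QP.*-zeroʳ (ℕ→ℚ (k l)))
      ... | no 0≮kₗ = trans (cong (λ t → ℕ→ℚ t * ⟪ Π l , Π i ⟫) (ℕP.n≤0⇒n≡0 (ℕP.≮⇒≥ 0≮kₗ)))
                           (QP.*-zeroˡ ⟪ Π l , Π i ⟫)
    reflection : ℕ→ℚ 2 * ⟪ β +ᵥ Π i , Π i ⟫ ≡ ℕ→ℚ 2 * ⟪ Π i , Π i ⟫
    reflection = cong (ℕ→ℚ 2 *_)
      (trans (ip-+ˡ β (Π i) (Π i)) (trans (cong (_+ ⟪ Π i , Π i ⟫) β⊥Πᵢ) (QP.+-identityˡ ⟪ Π i , Π i ⟫)))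
    β-Πᵢ∈Φ : (β -ᵥ Π i) ∈ Φ
    β-Πᵢ∈Φ = subst (_∈ Φ) (+ᵥ-2•-cancel β (Π i)) (reflection∈ (inΦ i) β+Πᵢ∈Φ (ℕ→ℚ 2) reflection)
    β-Πᵢ≡ : β -ᵥ Π i ≡ QComb c
    β-Πᵢ≡ = trans (cong (λ v → β -ᵥ v) (Π≡QComb-δ i)) (QComb--ᵥ (λ j → ℕ→ℚ (k j)) (δ i))
    cᵢ<0 : c i < 0ℚ
    cᵢ<0 = 0-1<0 (cong ℕ→ℚ kᵢ≡0) (δ-diag i)
    mixed-signs : (∃ λ l → 0 ℕ.< k l × 0ℚ < ⟪ β , Π l ⟫) → ⊥
    mixed-signs (l , 0<kₗ , _) = mixed-signs-¬root c {l} {i} (subst (_∈ Φ) β-Πᵢ≡ β-Πᵢ∈Φ) 0<cₗ cᵢ<0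
      where
      l≢i : l ≢ i
      l≢i l≡i = ℕP.<-irrefl (sym (trans (cong k l≡i) kᵢ≡0)) 0<kₗ
      0<cₗ : 0ℚ < c l
      0<cₗ = subst (0ℚ <_) (sym (trans (cong (λ t → ℕ→ℚ (k l) - t) (δ-offdiag l≢i)) (p-0≡p (ℕ→ℚ (k l)))))
                   (ℕ→ℚ-pos 0<kₗ)

  sum-pred : ∀ {m} (k : Fin m → ℕ) i → 0 ℕ.< k i → sum k ≡ suc (sum (updateAt k i ℕ.pred))
  sum-pred k zero 0<k₀ = cong (ℕ._+ sum (k ∘ suc)) (sym (ℕP.suc-pred (k zero) {{ℕ.>-nonZero 0<k₀}}))
  sum-pred k (suc i) 0<kᵢ = trans (cong (k zero ℕ.+_) (sum-pred (k ∘ suc) i 0<kᵢ)) (ℕP.+-suc (k zero) _)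

  simple-support : ∀ k {i} → ℕComb Π k ≡ Π i → ∀ l → 0 ℕ.< k l → l ≡ i
  simple-support k {i} β≡Πᵢ l 0<kₗ = decidable-stable (l F.≟ i) λ l≢i →
    QP.<-irrefl (sym (trans (QComb-injective (λ j → ℕ→ℚ (k j)) (δ i) (trans β≡Πᵢ (Π≡QComb-δ i)) l) (δ-offdiag l≢i)))
                (ℕ→ℚ-pos 0<kₗ)

  -- Supports of roots are connected: a root arises from a simple root by adding simple roots, and a
  -- simple root orthogonal to everything added so far cannot be added, as reflecting in it would
  -- produce a root of mixed signs.
  module Support (C : Fin n → Set) (C? : ∀ i → Dec (C i)) (C-orth : ∀ {i j} → C i → ¬ C j → ⟪ Π i , Π j ⟫ ≡ 0ℚ) where

    Homogeneous : (Fin n → ℕ) → Set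
    Homogeneous k = (∀ i → 0 ℕ.< k i → C i) ⊎ (∀ i → 0 ℕ.< k i → ¬ C i)

    simple-homogeneous : ∀ k i → ℕComb Π k ≡ Π i → Homogeneous k
    simple-homogeneous k i β≡Πᵢ with C? i
    ... | yes Cᵢ = inj₁ λ l 0<kₗ → subst C (sym (simple-support k β≡Πᵢ l 0<kₗ)) Cᵢ
    ... | no ¬Cᵢ = inj₂ λ l 0<kₗ → subst (¬_ ∘ C) (sym (simple-support k β≡Πᵢ l 0<kₗ)) ¬Cᵢ

    homogeneous-+simple : ∀ {k k′} i → ℕComb Π k′ ∈ Φ → (ℕComb Π k′ +ᵥ Π i) ∈ Φ →
                          (∀ l → 0 ℕ.< k l → l ≡ i ⊎ 0 ℕ.< k′ l) → Homogeneous k′ → Homogeneous k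
    homogeneous-+simple {k′ = k′} i β′∈Φ β∈Φ support (inj₁ inside) with C? i
    ... | yes Cᵢ = inj₁ λ l 0<kₗ → [ (λ l≡i → subst C (sym l≡i) Cᵢ) , inside l ] (support l 0<kₗ)
    ... | no ¬Cᵢ = ⊥-elim (orthogonal-extension-¬root i β′∈Φ (ℕP.n≤0⇒n≡0 (ℕP.≮⇒≥ (¬Cᵢ ∘ inside i)))
                            (λ l 0<k′ₗ → C-orth (inside l 0<k′ₗ) ¬Cᵢ) β∈Φ)
    homogeneous-+simple {k′ = k′} i β′∈Φ β∈Φ support (inj₂ outside) with C? i
    ... | no ¬Cᵢ = inj₂ λ l 0<kₗ → [ (λ l≡i → subst (¬_ ∘ C) (sym l≡i) ¬Cᵢ) , outside l ] (support l 0<kₗ)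
    ... | yes Cᵢ = ⊥-elim (orthogonal-extension-¬root i β′∈Φ (ℕP.n≤0⇒n≡0 (ℕP.≮⇒≥ (λ 0<k′ᵢ → outside i 0<k′ᵢ Cᵢ)))
                            (λ l 0<k′ₗ → trans (ip-sym (Π l) (Π i)) (C-orth Cᵢ (outside l 0<k′ₗ))) β∈Φ)

    support-homogeneous : ∀ k → ℕComb Π k ∈ Φ → Homogeneous k
    support-homogeneous k = by-height (suc (sum k)) k ℕP.≤-refl
      where
      by-height : ∀ h k → sum k ℕ.< h → ℕComb Π k ∈ Φ → Homogeneous k
      by-height (suc h) k sum<h β∈Φ = descend (acute-simple-in-support β∈Φ)
        where
        descend : (∃ λ i → 0 ℕ.< k i × 0ℚ < ⟪ ℕComb Π k , Π i ⟫) → Homogeneous k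
        descend (i , 0<kᵢ , 0<βΠᵢ) with ℕComb Π k ≟ᵥ Π i
        ... | yes β≡Πᵢ = simple-homogeneous k i β≡Πᵢ
        ... | no β≢Πᵢ = homogeneous-+simple i β′∈Φ (subst (_∈ Φ) (sym β′+Πᵢ≡β) β∈Φ) support
                          (by-height h k′ (subst (ℕ._≤ h) (sum-pred k i 0<kᵢ) (ℕP.≤-pred sum<h)) β′∈Φ)
          where
          k′ = updateAt k i ℕ.pred
          β′∈Φ : ℕComb Π k′ ∈ Φ
          β′∈Φ = subst (_∈ Φ) (ℕComb-pred k i 0<kᵢ) (difference∈ β∈Φ (inΦ i) 0<βΠᵢ β≢Πᵢ)
          β′+Πᵢ≡β : ℕComb Π k′ +ᵥ Π i ≡ ℕComb Π k
          β′+Πᵢ≡β = trans (cong (_+ᵥ Π i) (sym (ℕComb-pred k i 0<kᵢ))) (-ᵥ-+ᵥ-cancel (ℕComb Π k) (Π i))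
          support : ∀ l → 0 ℕ.< k l → l ≡ i ⊎ 0 ℕ.< k′ l
          support l 0<kₗ with l F.≟ i
          ... | yes l≡i = inj₁ l≡i
          ... | no l≢i = inj₂ (subst (0 ℕ.<_) (sym (updateAt-minimal l i k l≢i)) 0<kₗ)

-- The face F = conv Φ ∩ { x ∣ ⟪ x , ω ⟫ = 1 }

module Face {n′} (G : Gram (suc n′)) (euc : IsEuclidean G) (Φ : List (V (suc n′))) (rs : IsRootSystem G Φ)
            (Π : Fin (suc n′) → V (suc n′)) (ss : IsSimpleSystem Φ Π) (θ : V (suc n′)) (m : Fin (suc n′) → ℕ)
            (α : Fin (suc n′)) (ω : V (suc n′)) (hr : IsHighestRoot Φ Π θ) (θ≡m : θ ≡ ℕComb Π m)
            (cw : IsFundCoweight G Π α ω) (mα≡1 : m α ≡ 1) where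
  open SimpleSystem G euc Φ rs Π ss
  open IsSimpleSystem ss
  open Cone Φ

  n = suc n′

  ip-QComb-ω : ∀ c → ⟪ QComb c , ω ⟫ ≡ c α
  ip-QComb-ω c = begin
    ⟪ QComb c , ω ⟫               ≡⟨ ip-∑•ˡ c Π ω ⟩
    ∑ (λ i → c i * ⟪ Π i , ω ⟫)   ≡⟨ ∑-single α _ (λ j j≢α →
                                       trans (cong (c j *_) (proj₂ cw j j≢α)) (QP.*-zeroʳ (c j))) ⟩
    c α * ⟪ Π α , ω ⟫             ≡⟨ cong (c α *_) (proj₁ cw) ⟩
    c α * 1ℚ                      ≡⟨ QP.*-identityʳ (c α) ⟩
    c α ∎
    where open ≡-Reasoning

  ≼⇒ip-ω-≤ : ∀ {x y} → x ≼[ Π ] y → ⟪ x , ω ⟫ ≤ ⟪ y , ω ⟫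
  ≼⇒ip-ω-≤ {x} {y} (k , y-x≡k) = 0≤q-p⇒p≤q (subst (0ℚ ≤_) kα≡ (ℕ→ℚ-nonNeg (k α)))
    where
    kα≡ : ℕ→ℚ (k α) ≡ ⟪ y , ω ⟫ - ⟪ x , ω ⟫
    kα≡ = trans (sym (ip-QComb-ω (λ i → ℕ→ℚ (k i)))) (trans (cong ⟪_, ω ⟫ (sym y-x≡k)) (ip--ˡ y x ω))

  θ·ω≡1 : ⟪ θ , ω ⟫ ≡ 1ℚ
  θ·ω≡1 = trans (cong ⟪_, ω ⟫ θ≡m) (trans (ip-QComb-ω (λ i → ℕ→ℚ (m i))) (cong ℕ→ℚ mα≡1))

  face-root⇒ : ∀ {β} → IsPositiveRoot Φ Π β × Π α ≼[ Π ] β → InFace G Φ ω 1ℚ β × β ∈ Φ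
  face-root⇒ {β} ((β∈Φ , _) , Πα≼β) = (root-InCone β∈Φ , QP.≤-antisym β·ω≤1 1≤β·ω) , β∈Φ
    where
    β·ω≤1 : ⟪ β , ω ⟫ ≤ 1ℚ
    β·ω≤1 = subst (⟪ β , ω ⟫ ≤_) θ·ω≡1 (≼⇒ip-ω-≤ (proj₂ hr β∈Φ))
    1≤β·ω : 1ℚ ≤ ⟪ β , ω ⟫
    1≤β·ω = subst (_≤ ⟪ β , ω ⟫) (proj₁ cw) (≼⇒ip-ω-≤ Πα≼β)

  face-root⇐ : ∀ {β} → InFace G Φ ω 1ℚ β × β ∈ Φ → IsPositiveRoot Φ Π β × Π α ≼[ Π ] β
  face-root⇐ {β} ((_ , β·ω≡1) , β∈Φ) = from-sign (signed β∈Φ)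
    where
    from-sign : (Σ (Fin n → ℕ) λ k → β ≡ ℕComb Π k ⊎ β ≡ -ᵥ ℕComb Π k) → IsPositiveRoot Φ Π β × Π α ≼[ Π ] β
    from-sign (k , inj₁ β≡k) = (β∈Φ , k , β≡k) , updateAt k α ℕ.pred , trans (cong (_-ᵥ Π α) β≡k) (ℕComb-pred k α 0<kα)
      where
      kα≡1 : k α ≡ 1
      kα≡1 = ℕ→ℚ-injective {k α} {1}
               (trans (sym (ip-QComb-ω (λ i → ℕ→ℚ (k i)))) (trans (cong ⟪_, ω ⟫ (sym β≡k)) β·ω≡1))
      0<kα : 0 ℕ.< k α
      0<kα = ℕP.≤-reflexive (sym kα≡1)
    from-sign (k , inj₂ β≡-k) = ⊥-elim (QP.<-irrefl refl (begin-strict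
      0ℚ                         <⟨ QP.positive⁻¹ 1ℚ ⟩
      1ℚ                         ≡⟨ sym β·ω≡1 ⟩
      ⟪ β , ω ⟫                  ≡⟨ cong ⟪_, ω ⟫ β≡-k ⟩
      ⟪ -ᵥ ℕComb Π k , ω ⟫       ≡⟨ ip-negˡ (ℕComb Π k) ω ⟩
      - ⟪ ℕComb Π k , ω ⟫        ≡⟨ cong -_ (ip-QComb-ω (λ i → ℕ→ℚ (k i))) ⟩
      - ℕ→ℚ (k α)                ≤⟨ QP.neg-antimono-≤ (ℕ→ℚ-nonNeg (k α)) ⟩
      0ℚ ∎))
      where open QP.≤-Reasoning

  FaceEdge : Fin n → Set
  FaceEdge j = Σ (V n) λ a → a ∈ Φ × (a -ᵥ Π j) ∈ Φ × ⟪ a , ω ⟫ ≡ 1ℚ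

  faceEdge? : ∀ j → Dec (FaceEdge j)
  faceEdge? j = map′ (λ p → let a , a∈Φ , top = find p in a , a∈Φ , top) (λ (a , a∈Φ , top) → lose a∈Φ top)
                     (Any.any? {P = Top} (λ a → ((a -ᵥ Π j) ∈? Φ) ×-dec (⟪ a , ω ⟫ QP.≟ 1ℚ)) Φ)
    where
    open import Data.List.Membership.DecPropositional _≟ᵥ_ using (_∈?_)
    Top : V n → Set
    Top a = (a -ᵥ Π j) ∈ Φ × ⟪ a , ω ⟫ ≡ 1ℚ

  faceEdge-from-root : ∀ {x j} → x ∈ Φ → ⟪ x , ω ⟫ ≡ 1ℚ → ⟪ x , Π j ⟫ ≢ 0ℚ → j ≢ α → FaceEdge j
  faceEdge-from-root {x} {j} x∈Φ x·ω≡1 xΠⱼ≢0 j≢α = by-sign (QP.<-cmp ⟪ x , Π j ⟫ 0ℚ)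
    where
    Πⱼ·ω≡0 : ⟪ Π j , ω ⟫ ≡ 0ℚ
    Πⱼ·ω≡0 = proj₂ cw j j≢α
    x≢Πⱼ : x ≢ Π j
    x≢Πⱼ x≡Πⱼ = QP.1≢0 (trans (sym x·ω≡1) (trans (cong ⟪_, ω ⟫ x≡Πⱼ) Πⱼ·ω≡0))
    x≢-Πⱼ : x ≢ -ᵥ Π j
    x≢-Πⱼ x≡-Πⱼ =
      QP.1≢0 (trans (sym x·ω≡1) (trans (cong ⟪_, ω ⟫ x≡-Πⱼ) (trans (ip-negˡ (Π j) ω) (cong -_ Πⱼ·ω≡0))))
    by-sign : Tri (⟪ x , Π j ⟫ < 0ℚ) (⟪ x , Π j ⟫ ≡ 0ℚ) (0ℚ < ⟪ x , Π j ⟫) → FaceEdge j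
    by-sign (tri< xΠⱼ<0 _ _) = x +ᵥ Π j , sum∈ x∈Φ (inΦ j) xΠⱼ<0 x≢-Πⱼ , subst (_∈ Φ) (sym (+ᵥ--ᵥ-cancel x (Π j))) x∈Φ ,
                               trans (ip-+ˡ x (Π j) ω) (trans (cong₂ _+_ x·ω≡1 Πⱼ·ω≡0) (QP.+-identityʳ 1ℚ))
    by-sign (tri≈ _ xΠⱼ≡0 _) = ⊥-elim (xΠⱼ≢0 xΠⱼ≡0)
    by-sign (tri> _ _ 0<xΠⱼ) = x , x∈Φ , difference∈ x∈Φ (inΦ j) 0<xΠⱼ x≢Πⱼ , x·ω≡1

  Attached : Fin n → Set
  Attached j = j ≡ α ⊎ FaceEdge j

  attached? : ∀ j → Dec (Attached j)
  attached? j = (j F.≟ α) ⊎-dec faceEdge? j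

  attached-orth : ∀ {i j} → Attached i → ¬ Attached j → ⟪ Π i , Π j ⟫ ≡ 0ℚ
  attached-orth {i} {j} attachedᵢ ¬attachedⱼ =
    QP.≤-antisym (simple-obtuse i≢j) (QP.≮⇒≥ λ ΠᵢΠⱼ<0 → ¬attachedⱼ (inj₂ (edge (QP.<⇒≢ ΠᵢΠⱼ<0))))
    where
    i≢j : i ≢ j
    i≢j i≡j = ¬attachedⱼ (subst Attached i≡j attachedᵢ)
    j≢α : j ≢ α
    j≢α = ¬attachedⱼ ∘ inj₁
    -- ⟪ a , Π j ⟫ and ⟪ a - Π i , Π j ⟫ differ by ⟪ Π i , Π j ⟫ ≢ 0, so one of them is nonzero
    edge-from-FaceEdge : i ≢ α → ⟪ Π i , Π j ⟫ ≢ 0ℚ → FaceEdge i → FaceEdge j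
    edge-from-FaceEdge i≢α ΠᵢΠⱼ≢0 (a , a∈Φ , a-Πᵢ∈Φ , a·ω≡1) = by-cases (⟪ a , Π j ⟫ QP.≟ 0ℚ)
      where
      by-cases : Dec (⟪ a , Π j ⟫ ≡ 0ℚ) → FaceEdge j
      by-cases (no aΠⱼ≢0) = faceEdge-from-root a∈Φ a·ω≡1 aΠⱼ≢0 j≢α
      by-cases (yes aΠⱼ≡0) = faceEdge-from-root a-Πᵢ∈Φ a-Πᵢ·ω≡1 a-Πᵢ·Πⱼ≢0 j≢α
        where
        a-Πᵢ·ω≡1 : ⟪ a -ᵥ Π i , ω ⟫ ≡ 1ℚ
        a-Πᵢ·ω≡1 = trans (ip--ˡ a (Π i) ω) (trans (cong₂ _-_ a·ω≡1 (proj₂ cw i i≢α)) (p-0≡p 1ℚ))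
        a-Πᵢ·Πⱼ≢0 : ⟪ a -ᵥ Π i , Π j ⟫ ≢ 0ℚ
        a-Πᵢ·Πⱼ≢0 e = ΠᵢΠⱼ≢0 (QP.neg-injective (begin
          - ⟪ Π i , Π j ⟫                   ≡⟨ sym (QP.+-identityˡ _) ⟩
          0ℚ - ⟪ Π i , Π j ⟫                ≡⟨ cong (_- ⟪ Π i , Π j ⟫) (sym aΠⱼ≡0) ⟩
          ⟪ a , Π j ⟫ - ⟪ Π i , Π j ⟫       ≡⟨ sym (ip--ˡ a (Π i) (Π j)) ⟩
          ⟪ a -ᵥ Π i , Π j ⟫                ≡⟨ e ⟩
          0ℚ ∎))
          where open ≡-Reasoning
    edge : ⟪ Π i , Π j ⟫ ≢ 0ℚ → FaceEdge j
    edge ΠᵢΠⱼ≢0 with i F.≟ α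
    ... | yes refl = faceEdge-from-root (inΦ α) (proj₁ cw) ΠᵢΠⱼ≢0 j≢α
    ... | no i≢α = [ ⊥-elim ∘ i≢α , edge-from-FaceEdge i≢α ΠᵢΠⱼ≢0 ] attachedᵢ

  highest-root-full-support : ∀ j → 0 ℕ.< m j
  highest-root-full-support j = ℕP.n≢0⇒n>0 λ mⱼ≡0 →
    QP.<-irrefl refl (QP.<-≤-trans (cⱼ<0 mⱼ≡0) (ℕComb-nonNeg c k θ-Πⱼ≡k j))
    where
    c : Fin n → ℚ
    c l = ℕ→ℚ (m l) - δ j l
    k = proj₁ (proj₂ hr (inΦ j))
    θ-Πⱼ≡k : QComb c ≡ ℕComb Π k
    θ-Πⱼ≡k = trans (sym (QComb--ᵥ (λ l → ℕ→ℚ (m l)) (δ j)))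
                   (trans (cong₂ _-ᵥ_ (sym θ≡m) (sym (Π≡QComb-δ j))) (proj₂ (proj₂ hr (inΦ j))))
    cⱼ<0 : m j ≡ 0 → c j < 0ℚ
    cⱼ<0 mⱼ≡0 = 0-1<0 (cong ℕ→ℚ mⱼ≡0) (δ-diag j)

  θ∈Φ : ℕComb Π m ∈ Φ
  θ∈Φ = subst (_∈ Φ) θ≡m (proj₁ hr)

  all-attached : ∀ j → Attached j
  all-attached j = from-homogeneous (support-homogeneous m θ∈Φ)
    where
    open Support Attached attached? attached-orth
    from-homogeneous : Homogeneous m → Attached j
    from-homogeneous (inj₁ inside) = inside j (highest-root-full-support j)
    from-homogeneous (inj₂ outside) = ⊥-elim (outside α (highest-root-full-support α) (inj₁ refl))

  face-edge : ∀ j → j ≢ α → FaceEdge j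
  face-edge j j≢α = from-attached (all-attached j)
    where
    from-attached : Attached j → FaceEdge j
    from-attached (inj₁ j≡α) = ⊥-elim (j≢α j≡α)
    from-attached (inj₂ faceEdgeⱼ) = faceEdgeⱼ

  γ : Fin n′ → Fin n
  γ = punchIn α

  top bottom : Fin n′ → V n
  top i = proj₁ (face-edge (γ i) (FP.punchInᵢ≢i α i))
  bottom i = top i -ᵥ Π (γ i)

  top∈Φ : ∀ i → top i ∈ Φ
  top∈Φ i = proj₁ (proj₂ (face-edge (γ i) (FP.punchInᵢ≢i α i)))

  bottom∈Φ : ∀ i → bottom i ∈ Φ
  bottom∈Φ i = proj₁ (proj₂ (proj₂ (face-edge (γ i) (FP.punchInᵢ≢i α i))))

  top·ω≡1 : ∀ i → ⟪ top i , ω ⟫ ≡ 1ℚ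
  top·ω≡1 i = proj₂ (proj₂ (proj₂ (face-edge (γ i) (FP.punchInᵢ≢i α i))))

  bottom·ω≡1 : ∀ i → ⟪ bottom i , ω ⟫ ≡ 1ℚ
  bottom·ω≡1 i = trans (ip--ˡ (top i) (Π (γ i)) ω)
                       (trans (cong₂ _-_ (top·ω≡1 i) (proj₂ cw (γ i) (FP.punchInᵢ≢i α i))) (p-0≡p 1ℚ))

  N : ℚ
  N = 1ℚ + ∑ {n′} (λ _ → 1ℚ)

  0<N : 0ℚ < N
  0<N = QP.<-≤-trans (QP.positive⁻¹ 1ℚ) (p≤p+q 1ℚ (∑-nonNeg {n′} (λ _ → 1ℚ) λ _ → QP.nonNegative⁻¹ 1ℚ))

  -- opaque, as unfolding the normal form of 1/N makes type checking blow up
  opaque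
    1/N : ℚ
    1/N = (Q.1/ N) {{Q.>-nonZero 0<N}}

    1/N*N≡1 : 1/N * N ≡ 1ℚ
    1/N*N≡1 = QP.*-inverseˡ N {{Q.>-nonZero 0<N}}

    0<1/N : 0ℚ < 1/N
    0<1/N = 0<*⇒0<ʳ {N} {1/N} (QP.<⇒≤ 0<N) (subst (0ℚ <_) (sym (QP.*-inverseʳ N {{Q.>-nonZero 0<N}})) (QP.positive⁻¹ 1ℚ))

  barycentre : (Fin n′ → V n) → V n
  barycentre f = 1/N • (Π α +ᵥ ∑ᵥ f)

  barycentre-InConv : ∀ {f} → (∀ l → f l ∈ Φ) → InConv Φ (barycentre f)
  barycentre-InConv {f} f∈Φ = subst (InCone (barycentre f)) 1/N*N≡1
    (InCone-• (1/N) (QP.<⇒≤ 0<1/N) (InCone-+ (root-InCone (inΦ α)) (InCone-∑ f (λ _ → 1ℚ) (root-InCone ∘ f∈Φ))))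

  barycentre-ω : ∀ {f} → (∀ l → ⟪ f l , ω ⟫ ≡ 1ℚ) → ⟪ barycentre f , ω ⟫ ≡ 1ℚ
  barycentre-ω {f} f·ω≡1 = begin
    ⟪ barycentre f , ω ⟫                               ≡⟨ ip-•ˡ (1/N) (Π α +ᵥ ∑ᵥ f) ω ⟩
    1/N * ⟪ Π α +ᵥ ∑ᵥ f , ω ⟫                       ≡⟨ cong (1/N *_) (ip-+ˡ (Π α) (∑ᵥ f) ω) ⟩
    1/N * (⟪ Π α , ω ⟫ + ⟪ ∑ᵥ f , ω ⟫)              ≡⟨ cong (λ t → 1/N * (⟪ Π α , ω ⟫ + t)) (ip-∑ˡ f ω) ⟩
    1/N * (⟪ Π α , ω ⟫ + ∑ (λ l → ⟪ f l , ω ⟫))     ≡⟨ cong₂ (λ s t → 1/N * (s + t)) (proj₁ cw) (∑-cong f·ω≡1) ⟩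
    1/N * N                                         ≡⟨ 1/N*N≡1 ⟩
    1ℚ ∎
    where open ≡-Reasoning

  lookup-barycentre : ∀ f y → lookup (barycentre f) y ≡ 1/N * (lookup (Π α) y + ∑ (λ l → lookup (f l) y))
  lookup-barycentre f y = trans (lookup-• (1/N) (Π α +ᵥ ∑ᵥ f) y)
    (cong (1/N *_) (trans (lookup-+ᵥ (Π α) (∑ᵥ f) y) (cong (lookup (Π α) y +_) (lookup-∑ᵥ f y))))

  point : Fin (suc n′) → V n
  point zero = barycentre bottom
  point (suc i) = barycentre (updateAt bottom i (λ _ → top i))

  point-in-face : ∀ i → InFace G Φ ω 1ℚ (point i)
  point-in-face zero = barycentre-InConv bottom∈Φ , barycentre-ω bottom·ω≡1
  point-in-face (suc i) = barycentre-InConv (updateAt-∀ (_∈ Φ) bottom i bottom∈Φ (top∈Φ i))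
                        , barycentre-ω (updateAt-∀ (λ v → ⟪ v , ω ⟫ ≡ 1ℚ) bottom i bottom·ω≡1 (top·ω≡1 i))

  point-edge : ∀ i → point (suc i) -ᵥ point zero ≡ 1/N • Π (γ i)
  point-edge i = ≡-by-lookup λ y → begin
    lookup (barycentre f -ᵥ barycentre bottom) y
      ≡⟨ lookup--ᵥ (barycentre f) (barycentre bottom) y ⟩
    lookup (barycentre f) y - lookup (barycentre bottom) y
      ≡⟨ cong₂ _-_ (lookup-barycentre f y) (lookup-barycentre bottom y) ⟩
    1/N * (π y + ∑ (F y)) - 1/N * (π y + ∑ (B y))
      ≡⟨ solve 4 (λ e p s t → e :* (p :+ s) :- e :* (p :+ t) := e :* (s :- t)) refl (1/N) (π y) (∑ (F y)) (∑ (B y)) ⟩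
    1/N * (∑ (F y) - ∑ (B y))
      ≡⟨ cong (1/N *_) (∑-difference-single (F y) (B y) i λ l l≢i → cong (λ v → lookup v y) (updateAt-minimal l i bottom l≢i)) ⟩
    1/N * (F y i - B y i)
      ≡⟨ cong (λ v → 1/N * (lookup v y - B y i)) (updateAt-updates i {λ _ → top i} bottom) ⟩
    1/N * (lookup (top i) y - lookup (bottom i) y)
      ≡⟨ cong (λ t → 1/N * (lookup (top i) y - t)) (lookup--ᵥ (top i) (Π (γ i)) y) ⟩
    1/N * (lookup (top i) y - (lookup (top i) y - lookup (Π (γ i)) y))
      ≡⟨ cong (1/N *_) (solve 2 (λ a p → a :- (a :- p) := p) refl (lookup (top i) y) (lookup (Π (γ i)) y)) ⟩
    1/N * lookup (Π (γ i)) y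
      ≡⟨ sym (lookup-• (1/N) (Π (γ i)) y) ⟩
    lookup (1/N • Π (γ i)) y ∎
    where
    open ≡-Reasoning
    f : Fin n′ → V n
    f = updateAt bottom i (λ _ → top i)
    π : Fin n → ℚ
    π y = lookup (Π α) y
    F B : Fin n → Fin n′ → ℚ
    F y l = lookup (f l) y
    B y l = lookup (bottom l) y

  points-AffIndep : AffIndep point
  points-AffIndep = LinIndep-cong {u = λ i → 1/N • Π (γ i)} (sym ∘ point-edge)
                      (LinIndep-• {v = Π ∘ γ} 0<1/N (LinIndep-punchIn {v = Π} α indep))

  face-dim : HasDim (InFace G Φ ω 1ℚ) n′
  face-dim = (point , point-in-face , points-AffIndep) ,
             λ p p∈F → hyperplane-¬AffIndep G (proj₁ euc) {Π α} {ω} (proj₁ cw) p (proj₂ ∘ p∈F)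

  face-roots : ∀ β → (IsPositiveRoot Φ Π β × Π α ≼[ Π ] β) ⇔ (InFace G Φ ω 1ℚ β × β ∈ Φ)
  face-roots β = mk⇔ face-root⇒ face-root⇐

proposition3p1 : ∀ {n} (G : Gram n) (Φ : List (V n)) (Π : Fin n → V n)
    (θ : V n) (m : Fin n → ℕ) (α : Fin n) (ω : V n) →
    IsEuclidean G → IsRootSystem G Φ → IsIrreducible G Φ →
    IsSimpleSystem Φ Π → IsHighestRoot Φ Π θ → θ ≡ ℕComb Π m →
    IsFundCoweight G Π α ω → m α ≡ 1 →
    HasDim (InFace G Φ ω (ℕ→ℚ (m α))) (n ∸ 1)
    × (∀ (β : V n) → (IsPositiveRoot Φ Π β × Π α ≼[ Π ] β)
                       ⇔ (InFace G Φ ω (ℕ→ℚ (m α)) β × β ∈ Φ))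
proposition3p1 {zero} _ _ _ _ _ () _ _ _ _ _ _ _ _ _
proposition3p1 {suc n′} G Φ Π θ m α ω euc rs _ ss hr θ≡m cw mα≡1 rewrite mα≡1 = face-dim , face-roots
  where open Face G euc Φ rs Π ss θ m α ω hr θ≡m cw mα≡1
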